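{- For positive integers $m$ and $n$: (i) $\frac{2n+1}{2m+1}\in\mathbb{Z}$ if and only if $P_n(x)/P_m(x)\in\mathbb{Z}[x]$, and if and only if $P^{\rm Inv}_n(x)/P^{\rm Inv}_m(x)\in\mathbb{Z}[x]$; (ii) $n/m$ is an odd integer if and only if $Q_n(x)/Q_m(x)\in\mathbb{Z}[x]$, and if and only if $Q^{\rm Inv}_n(x)/Q^{\rm Inv}_m(x)\in\mathbb{Z}[x]$; (iii) for every positive integer $a$, $\frac{2n+1}{2m+1}\in\mathbb{Z}$ if and only if $\frac{(a+1)^{2n+1}-a^{2n+1}}{(a+1)^{2m+1}-a^{2m+1}}\in\mathbb{N}$; (iv) for every positive integer $a$, $n/m$ is an odd integer if and only if $\frac{(a+1)^{2n}+a^{2n}}{(a+1)^{2m}+a^{2m}}\in\mathbb{N}$.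
   Context: For integers $n,k\ge0$: $T_k(n)=\binom{n+k+1}{2k+1}+\binom{n+k}{2k+1}$, $U_k(n)=\binom{n+k}{2k}+\binom{n+k-1}{2k}$ for $k\ge1$, $U_0(n)=2$. $P_n(x)=\sum_{k=0}^nT_k(n)x^k$, $Q_n(x)=\sum_{k=0}^nU_k(n)x^k$, $P^{\rm Inv}_n(x)=x^nP_n(1/x)$, $Q^{\rm Inv}_n(x)=x^nQ_n(1/x)$. -}

module Defs where

open import Data.Nat using (ℕ; zero; suc; _+_; _*_; _∸_; _^_)
open import Data.Nat.Combinatorics using (_C_)
open import Data.Integer as ℤ using (ℤ)
open import Data.List using (List; []; _∷_; map; reverse; upTo)
open import Data.Product using (∃; ∃-syntax)
open import Relation.Binary.PropositionalEquality using (_≡_)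

T : ℕ → ℕ → ℕ
T k n = ((n + k + 1) C (2 * k + 1)) + ((n + k) C (2 * k + 1))

U : ℕ → ℕ → ℕ
U zero    n = 2
U (suc j) n = ((n + suc j) C (2 * suc j)) + ((n + suc j ∸ 1) C (2 * suc j))

-- Integer polynomials as coefficient lists (constant term first).
Poly : Set
Poly = List ℤ

coeff : Poly → ℕ → ℤ
coeff []       _       = ℤ.0ℤ
coeff (c ∷ cs) zero    = c
coeff (c ∷ cs) (suc k) = coeff cs k

sumTo : ℕ → (ℕ → ℤ) → ℤ
sumTo zero    f = f zero
sumTo (suc k) f = sumTo k f ℤ.+ f (suc k)

mulCoeff : Poly → Poly → ℕ → ℤ
mulCoeff p q k = sumTo k (λ i → coeff p i ℤ.* coeff q (k ∸ i))

_∣ₚ_ : Poly → Poly → Set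
q ∣ₚ p = ∃[ r ] (∀ k → coeff p k ≡ mulCoeff q r k)

P : ℕ → Poly
P n = map (λ k → ℤ.+ T k n) (upTo (suc n))

Q : ℕ → Poly
Q n = map (λ k → ℤ.+ U k n) (upTo (suc n))

-- x^n P_n(1/x): coefficient list reversed
PInv : ℕ → Poly
PInv n = reverse (P n)

QInv : ℕ → Poly
QInv n = reverse (Q n)

OddQuot : ℕ → ℕ → Set
OddQuot n m = ∃[ k ] (n ≡ (2 * k + 1) * m)

-- P_n and Q_n are Chebyshev-like: by Pascal's rule both satisfy F(n+2) = (x+2) F(n+1) - F(n),
-- and after extending them to negative indices by P(-1-n) = -P(n), Q(-n) = Q(n), every such
-- solution satisfies F(j+k) + F(j-k) = F(j) Q(k).  With j = m this gives P_m | P_(m+t(2m+1)) and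
-- Q_m | Q_((2t+1)m).  Conversely P_n(0) = 2n+1, while w_n = Q_n(1) increases strictly and satisfies
-- w_(m+r) + w_|m-r| = w_m w_r, so w_m | w_n makes w_m divide w_(n mod 2m), which forces n ≡ m
-- (mod 2m).  Reversing coefficients is multiplicative, hence preserves divisibility between
-- polynomials with nonzero constant and leading coefficients, which gives the reciprocal forms.
-- For (iii) and (iv) put x = a+1 and y = a.  Both x^A - y^A and x^A + y^A are coprime to y;
-- modulo the first, x^(j+A) - y^(j+A) ≡ y^A (x^j - y^j), and modulo the second,
-- x^(j+A) ± y^(j+A) ≡ -y^A (x^j ∓ y^j).  So divisibility by them is periodic in the exponent
-- (with periods A and 2A) and reduces to exponents below A.

module Submission where

open import Defs
open import Data.Nat as ℕ using (ℕ; zero; suc; _≤_; _<_; _≥_; z≤n; s≤s)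
import Data.Nat.Properties as ℕP
open import Relation.Binary.PropositionalEquality

-- Binomial identities for T and U

module _ where
  open import Data.Nat using (_+_; _*_; _∸_)
  open import Data.Nat.Combinatorics using (_C_; nCn≡1; nC1≡n; k>n⇒nCk≡0; nCk+nC[k+1]≡[n+1]C[k+1])
  open import Data.Nat.Tactic.RingSolver using (solve-∀)
  open import Function using (_∘_)
  open ≡-Reasoning

  pairC : ℕ → ℕ → ℕ
  pairC s X = suc X C s + X C s

  private
    pascal : ∀ n k → n C k + n C suc k ≡ suc n C suc k
    pascal = nCk+nC[k+1]≡[n+1]C[k+1]

    swap-middle : ∀ a b c d → (a + b) + (c + d) ≡ (a + c) + (b + d)
    swap-middle = solve-∀

  pascal₂ : ∀ N s → (2 + N) C (2 + s) + N C (2 + s) ≡ N C s + 2 * (suc N C (2 + s))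
  pascal₂ N s = begin
    (2 + N) C (2 + s) + c    ≡⟨ cong (_+ c) (sym (pascal (suc N) (suc s))) ⟩
    (suc N C suc s + d) + c  ≡⟨ cong (λ t → (t + d) + c) (sym (pascal N s)) ⟩
    ((a + b) + d) + c        ≡⟨ regroup a b c d ⟩
    (a + d) + (b + c)        ≡⟨ cong ((a + d) +_) (pascal N (suc s)) ⟩
    (a + d) + d              ≡⟨ double a d ⟩
    a + 2 * d                ∎
    where
    a = N C s
    b = N C suc s
    c = N C (2 + s)
    d = suc N C (2 + s)
    regroup : ∀ a b c d → ((a + b) + d) + c ≡ (a + d) + (b + c)
    regroup = solve-∀
    double : ∀ a d → (a + d) + d ≡ a + 2 * d
    double = solve-∀

  pairC-rec : ∀ s N → pairC (2 + s) (2 + N) + pairC (2 + s) N ≡ pairC s N + 2 * pairC (2 + s) (suc N)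
  pairC-rec s N = begin
    (R (3 + N) + R (2 + N)) + (R (1 + N) + R N)
      ≡⟨ swap-middle (R (3 + N)) _ _ _ ⟩
    (R (3 + N) + R (1 + N)) + (R (2 + N) + R N)
      ≡⟨ cong₂ _+_ (pascal₂ (suc N) s) (pascal₂ N s) ⟩
    (suc N C s + 2 * R (2 + N)) + (N C s + 2 * R (1 + N))
      ≡⟨ collect (suc N C s) (R (2 + N)) (N C s) (R (1 + N)) ⟩
    (suc N C s + N C s) + 2 * (R (2 + N) + R (1 + N)) ∎
    where
    R : ℕ → ℕ
    R X = X C (2 + s)
    collect : ∀ a b c d → (a + 2 * b) + (c + 2 * d) ≡ (a + c) + 2 * (b + d)
    collect = solve-∀

  pairC-vanish : ∀ {s X} → suc X < s → pairC s X ≡ 0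
  pairC-vanish lt = cong₂ _+_ (k>n⇒nCk≡0 lt) (k>n⇒nCk≡0 (ℕP.<-trans (ℕP.n<1+n _) lt))

  pairC-top : ∀ X → pairC (suc X) X ≡ 1
  pairC-top X = cong₂ _+_ (nCn≡1 (suc X)) (k>n⇒nCk≡0 (ℕP.n<1+n X))

  T-pairC : ∀ k n → T k n ≡ pairC (2 * k + 1) (n + k)
  T-pairC k n = cong (λ X → X C (2 * k + 1) + (n + k) C (2 * k + 1)) (ℕP.+-comm (n + k) 1)

  T-suc : ∀ j n → T (suc j) n ≡ pairC (2 + (2 * j + 1)) (suc (n + j))
  T-suc j n = trans (T-pairC (suc j) n) (cong₂ pairC (reindex j) (ℕP.+-suc n j))
    where
    reindex : ∀ j → 2 * suc j + 1 ≡ 2 + (2 * j + 1)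
    reindex = solve-∀

  T-const : ∀ n → T 0 n ≡ 2 * n + 1
  T-const n = trans (cong₂ _+_ (nC1≡n (n + 0 + 1)) (nC1≡n (n + 0))) (simplify n)
    where
    simplify : ∀ n → n + 0 + 1 + (n + 0) ≡ 2 * n + 1
    simplify = solve-∀

  T-rec-zero : ∀ n → T 0 (2 + n) + T 0 n ≡ 2 * T 0 (1 + n)
  T-rec-zero n = begin
    T 0 (2 + n) + T 0 n                ≡⟨ cong₂ _+_ (T-const (2 + n)) (T-const n) ⟩
    (2 * (2 + n) + 1) + (2 * n + 1)    ≡⟨ linear n ⟩
    2 * (2 * (1 + n) + 1)              ≡⟨ cong (2 *_) (T-const (1 + n)) ⟨
    2 * T 0 (1 + n)                    ∎
    where
    linear : ∀ n → (2 * (2 + n) + 1) + (2 * n + 1) ≡ 2 * (2 * (1 + n) + 1)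
    linear = solve-∀

  T-rec-suc : ∀ j n → T (suc j) (2 + n) + T (suc j) n ≡ T j (1 + n) + 2 * T (suc j) (1 + n)
  T-rec-suc j n = begin
    T (suc j) (2 + n) + T (suc j) n
      ≡⟨ cong₂ _+_ (T-suc j (2 + n)) (T-suc j n) ⟩
    pairC (2 + s) (3 + n + j) + pairC (2 + s) (suc (n + j))
      ≡⟨ pairC-rec s (suc (n + j)) ⟩
    pairC s (suc (n + j)) + 2 * pairC (2 + s) (2 + n + j)
      ≡⟨ cong₂ (λ a b → a + 2 * b) (T-pairC j (1 + n)) (T-suc j (1 + n)) ⟨
    T j (1 + n) + 2 * T (suc j) (1 + n) ∎
    where
    s = 2 * j + 1

  T-vanish : ∀ {k n} → n < k → T k n ≡ 0
  T-vanish {k} {n} n<k =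
    trans (T-pairC k n) (pairC-vanish (subst (suc (n + k) <_) (sym (reindex k)) (s≤s (ℕP.+-monoˡ-< k n<k))))
    where
    reindex : ∀ k → 2 * k + 1 ≡ suc (k + k)
    reindex = solve-∀

  T-lead : ∀ n → T n n ≡ 1
  T-lead n = trans (T-pairC n n) (trans (cong (λ s → pairC s (n + n)) (reindex n)) (pairC-top (n + n)))
    where
    reindex : ∀ n → 2 * n + 1 ≡ suc (n + n)
    reindex = solve-∀

  U-pairC : ∀ k n → U k (suc n) ≡ pairC (2 * k) (n + k)
  U-pairC zero    n = refl
  U-pairC (suc k) n = refl

  U-suc : ∀ j n → U (suc j) n ≡ pairC (2 + 2 * j) (n + j)
  U-suc j n = cong₂ (λ X s → X C s + (X ∸ 1) C s) (ℕP.+-suc n j) (reindex j)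
    where
    reindex : ∀ j → 2 * suc j ≡ 2 + 2 * j
    reindex = solve-∀

  U-rec-zero : ∀ n → U 0 (2 + n) + U 0 n ≡ 2 * U 0 (1 + n)
  U-rec-zero n = refl

  U-rec-suc : ∀ j n → U (suc j) (2 + n) + U (suc j) n ≡ U j (1 + n) + 2 * U (suc j) (1 + n)
  U-rec-suc j n = begin
    U (suc j) (2 + n) + U (suc j) n
      ≡⟨ cong₂ _+_ (U-suc j (2 + n)) (U-suc j n) ⟩
    pairC (2 + 2 * j) (2 + n + j) + pairC (2 + 2 * j) (n + j)
      ≡⟨ pairC-rec (2 * j) (n + j) ⟩
    pairC (2 * j) (n + j) + 2 * pairC (2 + 2 * j) (1 + n + j)
      ≡⟨ cong₂ (λ a b → a + 2 * b) (U-pairC j n) (U-suc j (1 + n)) ⟨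
    U j (1 + n) + 2 * U (suc j) (1 + n) ∎

  U-vanish : ∀ {k n} → n < k → U k n ≡ 0
  U-vanish {suc j} {n} (s≤s n≤j) =
    trans (U-suc j n) (pairC-vanish (s≤s (s≤s (subst (n + j ≤_) (reindex j) (ℕP.+-monoˡ-≤ j n≤j)))))
    where
    reindex : ∀ j → j + j ≡ 2 * j
    reindex = solve-∀

  U-lead : ∀ j → U (suc j) (suc j) ≡ 1
  U-lead j = trans (U-pairC (suc j) j) (trans (cong (λ s → pairC s (j + suc j)) (reindex j)) (pairC-top (j + suc j)))
    where
    reindex : ∀ j → 2 * suc j ≡ suc (j + suc j)
    reindex = solve-∀

  T-const≢0 : ∀ n → T 0 n ≢ 0
  T-const≢0 n = ℕP.m+1+n≢0 (2 * n) ∘ trans (sym (T-const n))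

  T-lead≢0 : ∀ n → T n n ≢ 0
  T-lead≢0 n = ℕP.1+n≢0 ∘ trans (sym (T-lead n))

  U-const≢0 : ∀ n → U 0 n ≢ 0
  U-const≢0 n ()

  U-lead≢0 : ∀ n → U n n ≢ 0
  U-lead≢0 zero    ()
  U-lead≢0 (suc j) = ℕP.1+n≢0 ∘ trans (sym (U-lead j))

-- Integer polynomials as coefficient sequences

module _ where
  open import Data.Integer as ℤ using (ℤ; +_; -_; _+_; _*_; _-_; 0ℤ; 1ℤ; -[1+_]; _⊖_)
  import Data.Integer.Properties as ℤP
  open import Data.Integer.Tactic.RingSolver using (solve-∀)
  import Data.Nat.Tactic.RingSolver as ℕSolver
  open import Data.Product using (_×_; _,_; proj₁; proj₂; ∃-syntax)
  open import Data.Sum using (inj₁; inj₂; fromInj₂)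
  open import Data.List using (List; []; _∷_; map; length; reverse; upTo; downFrom; applyUpTo; applyDownFrom)
  import Data.List.Properties as ListP
  open import Data.Nat.ListAction using (sum)
  open import Data.Nat.Divisibility using (_∣_; divides)
  open import Data.Empty using (⊥-elim)
  open import Function using (_∘_; _⇔_; mk⇔)
  open import Function.Properties.Equivalence using () renaming (trans to ⇔-trans; sym to ⇔-sym)
  open import Relation.Nullary using (yes; no)
  open ≡-Reasoning

  Seq : Set
  Seq = ℕ → ℤ

  private
    swap-middle : ∀ a b c d → (a + b) + (c + d) ≡ (a + c) + (b + d)
    swap-middle = solve-∀

    sum≡⇒difference : ∀ e d {a b} → a ℕ.+ b ≡ e ℕ.+ 2 ℕ.* d → + a ≡ (+ e + + 2 * + d) + - + b
    sum≡⇒difference e d {a} {b} eq = begin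
      + a                          ≡⟨ add-sub (+ a) (+ b) ⟩
      + (a ℕ.+ b) + - + b          ≡⟨ cong (λ t → + t + - + b) eq ⟩
      + (e ℕ.+ 2 ℕ.* d) + - + b    ≡⟨ cong (λ t → + e + t + - + b) (ℤP.pos-* 2 d) ⟩
      (+ e + + 2 * + d) + - + b    ∎
      where
      add-sub : ∀ x y → x ≡ (x + y) + - y
      add-sub = solve-∀

  sumTo-cong : ∀ k {f g : Seq} → (∀ i → i ≤ k → f i ≡ g i) → sumTo k f ≡ sumTo k g
  sumTo-cong zero    eq = eq 0 z≤n
  sumTo-cong (suc k) eq = cong₂ _+_ (sumTo-cong k (λ i i≤k → eq i (ℕP.m≤n⇒m≤1+n i≤k))) (eq (suc k) ℕP.≤-refl)

  sumTo-zero : ∀ k {f : Seq} → (∀ i → i ≤ k → f i ≡ 0ℤ) → sumTo k f ≡ 0ℤ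
  sumTo-zero zero    eq = eq 0 z≤n
  sumTo-zero (suc k) eq = cong₂ _+_ (sumTo-zero k (λ i i≤k → eq i (ℕP.m≤n⇒m≤1+n i≤k))) (eq (suc k) ℕP.≤-refl)

  sumTo-+ : ∀ k (f g : Seq) → sumTo k (λ i → f i + g i) ≡ sumTo k f + sumTo k g
  sumTo-+ zero    f g = refl
  sumTo-+ (suc k) f g = trans (cong (_+ (f (suc k) + g (suc k))) (sumTo-+ k f g))
                              (swap-middle (sumTo k f) (sumTo k g) (f (suc k)) (g (suc k)))

  sumTo-* : ∀ k c (f : Seq) → sumTo k (λ i → c * f i) ≡ c * sumTo k f
  sumTo-* zero    c f = refl
  sumTo-* (suc k) c f = trans (cong (_+ (c * f (suc k))) (sumTo-* k c f))
                              (sym (ℤP.*-distribˡ-+ c (sumTo k f) (f (suc k))))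

  sumTo-neg : ∀ k (f : Seq) → sumTo k (λ i → - f i) ≡ - sumTo k f
  sumTo-neg zero    f = refl
  sumTo-neg (suc k) f = trans (cong (_+ (- f (suc k))) (sumTo-neg k f))
                              (sym (ℤP.neg-distrib-+ (sumTo k f) (f (suc k))))

  sumTo-suc : ∀ k (f : Seq) → sumTo (suc k) f ≡ f 0 + sumTo k (f ∘ suc)
  sumTo-suc zero    f = refl
  sumTo-suc (suc k) f = trans (cong (_+ f (2 ℕ.+ k)) (sumTo-suc k f))
                              (ℤP.+-assoc (f 0) (sumTo k (f ∘ suc)) (f (2 ℕ.+ k)))

  sumTo-single : ∀ k {m} (f : Seq) → m ≤ k → (∀ i → i ≤ k → i ≢ m → f i ≡ 0ℤ) → sumTo k f ≡ f m
  sumTo-single zero    f z≤n others = refl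
  sumTo-single (suc k) {m} f m≤1+k others with m ℕ.≟ suc k
  ... | yes refl = trans (cong (_+ f (suc k)) (sumTo-zero k below)) (ℤP.+-identityˡ _)
    where
    below : ∀ i → i ≤ k → f i ≡ 0ℤ
    below i i≤k = others i (ℕP.m≤n⇒m≤1+n i≤k) (ℕP.<⇒≢ (s≤s i≤k))
  ... | no m≢1+k = trans (cong₂ _+_ (sumTo-single k f m≤k (λ i i≤k → others i (ℕP.m≤n⇒m≤1+n i≤k)))
                                     (others (suc k) ℕP.≤-refl (m≢1+k ∘ sym)))
                         (ℤP.+-identityʳ _)
    where
    m≤k : m ≤ k
    m≤k = ℕP.≤-pred (ℕP.≤∧≢⇒< m≤1+k m≢1+k)

  infixl 6 _⊕_ _⊝_
  infixl 7 _⊛_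
  infixr 8 _·_

  _⊕_ : Seq → Seq → Seq
  (f ⊕ g) k = f k + g k

  neg : Seq → Seq
  neg f k = - f k

  _⊝_ : Seq → Seq → Seq
  f ⊝ g = f ⊕ neg g

  _·_ : ℤ → Seq → Seq
  (c · f) k = c * f k

  X∙_ : Seq → Seq
  (X∙ f) zero    = 0ℤ
  (X∙ f) (suc k) = f k

  const : ℤ → Seq
  const c zero    = c
  const c (suc k) = 0ℤ

  [x+2]∙_ : Seq → Seq
  [x+2]∙ f = X∙ f ⊕ (+ 2) · f

  _⊛_ : Seq → Seq → Seq
  (f ⊛ g) k = sumTo k (λ i → f i * g (k ℕ.∸ i))

  Deg≤ : ℕ → Seq → Set
  Deg≤ d f = ∀ k → d < k → f k ≡ 0ℤ

  const-⊕-X∙ : ∀ f → f ≗ const (f 0) ⊕ X∙ (f ∘ suc)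
  const-⊕-X∙ f zero    = sym (ℤP.+-identityʳ (f 0))
  const-⊕-X∙ f (suc k) = sym (ℤP.+-identityˡ (f (suc k)))

  [x+2]∙-cong : ∀ {f g} → f ≗ g → [x+2]∙ f ≗ [x+2]∙ g
  [x+2]∙-cong eq zero    = cong (λ t → 0ℤ + + 2 * t) (eq 0)
  [x+2]∙-cong eq (suc k) = cong₂ (λ a b → a + + 2 * b) (eq k) (eq (suc k))

  [x+2]∙-⊕ : ∀ f g → [x+2]∙ (f ⊕ g) ≗ [x+2]∙ f ⊕ [x+2]∙ g
  [x+2]∙-⊕ f g zero    = linear (f 0) (g 0)
    where
    linear : ∀ a b → 0ℤ + + 2 * (a + b) ≡ (0ℤ + + 2 * a) + (0ℤ + + 2 * b)
    linear = solve-∀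
  [x+2]∙-⊕ f g (suc k) = linear (f k) (g k) (f (suc k)) (g (suc k))
    where
    linear : ∀ a b c d → (a + b) + + 2 * (c + d) ≡ (a + + 2 * c) + (b + + 2 * d)
    linear = solve-∀

  [x+2]∙-neg : ∀ f → [x+2]∙ neg f ≗ neg ([x+2]∙ f)
  [x+2]∙-neg f zero    = linear (f 0)
    where
    linear : ∀ a → 0ℤ + + 2 * - a ≡ - (0ℤ + + 2 * a)
    linear = solve-∀
  [x+2]∙-neg f (suc k) = linear (f k) (f (suc k))
    where
    linear : ∀ a b → - a + + 2 * - b ≡ - (a + + 2 * b)
    linear = solve-∀

  ⊛-congˡ : ∀ {f f′} g → f ≗ f′ → f ⊛ g ≗ f′ ⊛ g
  ⊛-congˡ g eq k = sumTo-cong k (λ i _ → cong (_* g (k ℕ.∸ i)) (eq i))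

  ⊛-congʳ : ∀ f {g g′} → g ≗ g′ → f ⊛ g ≗ f ⊛ g′
  ⊛-congʳ f eq k = sumTo-cong k (λ i _ → cong (f i *_) (eq (k ℕ.∸ i)))

  ⊛-distribˡ-⊕ : ∀ f g h → f ⊛ (g ⊕ h) ≗ f ⊛ g ⊕ f ⊛ h
  ⊛-distribˡ-⊕ f g h k =
    trans (sumTo-cong k (λ i _ → ℤP.*-distribˡ-+ (f i) (g (k ℕ.∸ i)) (h (k ℕ.∸ i)))) (sumTo-+ k _ _)

  ⊛-distribʳ-⊕ : ∀ f g h → (f ⊕ g) ⊛ h ≗ f ⊛ h ⊕ g ⊛ h
  ⊛-distribʳ-⊕ f g h k =
    trans (sumTo-cong k (λ i _ → ℤP.*-distribʳ-+ (h (k ℕ.∸ i)) (f i) (g i))) (sumTo-+ k _ _)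

  ⊛-negʳ : ∀ f g → f ⊛ neg g ≗ neg (f ⊛ g)
  ⊛-negʳ f g k = trans (sumTo-cong k (λ i _ → sym (ℤP.neg-distribʳ-* (f i) (g (k ℕ.∸ i))))) (sumTo-neg k _)

  ⊛-distribˡ-⊝ : ∀ f g h → f ⊛ (g ⊝ h) ≗ f ⊛ g ⊝ f ⊛ h
  ⊛-distribˡ-⊝ f g h k = trans (⊛-distribˡ-⊕ f g (neg h) k) (cong (λ t → (f ⊛ g) k + t) (⊛-negʳ f h k))

  ⊛-·ʳ : ∀ f c g → f ⊛ c · g ≗ c · (f ⊛ g)
  ⊛-·ʳ f c g k = trans (sumTo-cong k (λ i _ → exchange (f i) c (g (k ℕ.∸ i)))) (sumTo-* k c _)
    where
    exchange : ∀ a b d → a * (b * d) ≡ b * (a * d)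
    exchange = solve-∀

  ⊛-X∙ˡ : ∀ f g → X∙ f ⊛ g ≗ X∙ (f ⊛ g)
  ⊛-X∙ˡ f g zero    = refl
  ⊛-X∙ˡ f g (suc k) = trans (sumTo-suc k _) (ℤP.+-identityˡ _)

  ⊛-X∙ʳ : ∀ f g → f ⊛ X∙ g ≗ X∙ (f ⊛ g)
  ⊛-X∙ʳ f g zero    = ℤP.*-zeroʳ (f 0)
  ⊛-X∙ʳ f g (suc k) = trans (cong₂ _+_ lower top) (ℤP.+-identityʳ _)
    where
    lower : sumTo k (λ i → f i * (X∙ g) (suc k ℕ.∸ i)) ≡ (f ⊛ g) k
    lower = sumTo-cong k (λ i i≤k → cong (λ t → f i * (X∙ g) t) (ℕP.+-∸-assoc 1 i≤k))
    top : f (suc k) * (X∙ g) (k ℕ.∸ k) ≡ 0ℤ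
    top = trans (cong (λ t → f (suc k) * (X∙ g) t) (ℕP.n∸n≡0 k)) (ℤP.*-zeroʳ (f (suc k)))

  ⊛-constˡ : ∀ c g → const c ⊛ g ≗ c · g
  ⊛-constˡ c g zero    = refl
  ⊛-constˡ c g (suc k) =
    trans (sumTo-suc k _) (trans (cong (λ t → c * g (suc k) + t) (sumTo-zero k (λ _ _ → refl))) (ℤP.+-identityʳ _))

  ⊛-constʳ : ∀ f c → f ⊛ const c ≗ c · f
  ⊛-constʳ f c k = begin
    (f ⊛ const c) k          ≡⟨ sumTo-single k _ ℕP.≤-refl off-diagonal ⟩
    f k * const c (k ℕ.∸ k)  ≡⟨ cong (λ t → f k * const c t) (ℕP.n∸n≡0 k) ⟩
    f k * c                  ≡⟨ ℤP.*-comm (f k) c ⟩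
    c * f k                  ∎
    where
    off-diagonal : ∀ i → i ≤ k → i ≢ k → f i * const c (k ℕ.∸ i) ≡ 0ℤ
    off-diagonal i i≤k i≢k with k ℕ.∸ i in eq
    ... | zero  = ⊥-elim (i≢k (ℕP.≤-antisym i≤k (ℕP.m∸n≡0⇒m≤n eq)))
    ... | suc _ = ℤP.*-zeroʳ (f i)

  ⊛-unfoldˡ : ∀ f g → f ⊛ g ≗ const (f 0) ⊛ g ⊕ X∙ ((f ∘ suc) ⊛ g)
  ⊛-unfoldˡ f g k = begin
    (f ⊛ g) k                                            ≡⟨ ⊛-congˡ g (const-⊕-X∙ f) k ⟩
    ((const (f 0) ⊕ X∙ (f ∘ suc)) ⊛ g) k                 ≡⟨ ⊛-distribʳ-⊕ (const (f 0)) (X∙ (f ∘ suc)) g k ⟩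
    (const (f 0) ⊛ g) k + (X∙ (f ∘ suc) ⊛ g) k           ≡⟨ cong (λ t → (const (f 0) ⊛ g) k + t) (⊛-X∙ˡ (f ∘ suc) g k) ⟩
    (const (f 0) ⊛ g ⊕ X∙ ((f ∘ suc) ⊛ g)) k             ∎

  ⊛-[x+2]∙ʳ : ∀ f g → f ⊛ [x+2]∙ g ≗ [x+2]∙ (f ⊛ g)
  ⊛-[x+2]∙ʳ f g k = trans (⊛-distribˡ-⊕ f (X∙ g) ((+ 2) · g) k) (cong₂ _+_ (⊛-X∙ʳ f g k) (⊛-·ʳ f (+ 2) g k))

  Deg≤-⊛ : ∀ {a b f g} → Deg≤ a f → Deg≤ b g → Deg≤ (a ℕ.+ b) (f ⊛ g)
  Deg≤-⊛ {a} {b} {f} {g} degf degg k a+b<k = sumTo-zero k term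
    where
    term : ∀ i → i ≤ k → f i * g (k ℕ.∸ i) ≡ 0ℤ
    term i i≤k with a ℕ.<? i
    ... | yes a<i = trans (cong (_* g (k ℕ.∸ i)) (degf i a<i)) (ℤP.*-zeroˡ (g (k ℕ.∸ i)))
    ... | no  a≮i = trans (cong (f i *_) (degg (k ℕ.∸ i) b<k∸i)) (ℤP.*-zeroʳ (f i))
      where
      b+i<k : b ℕ.+ i < k
      b+i<k = ℕP.≤-<-trans (ℕP.≤-trans (ℕP.+-monoʳ-≤ b (ℕP.≮⇒≥ a≮i)) (ℕP.≤-reflexive (ℕP.+-comm b a))) a+b<k
      b<k∸i : b < k ℕ.∸ i
      b<k∸i = ℕP.m+n≤o⇒m≤o∸n (suc b) b+i<k

  X∙-cong : ∀ {f g} → f ≗ g → X∙ f ≗ X∙ g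
  X∙-cong eq zero    = refl
  X∙-cong eq (suc k) = eq k

  Deg≤-const : ∀ d c → Deg≤ d (const c)
  Deg≤-const d c (suc k) _ = refl

  Deg≤0⇒const : ∀ {f} → Deg≤ 0 f → f ≗ const (f 0)
  Deg≤0⇒const deg zero    = refl
  Deg≤0⇒const deg (suc k) = deg (suc k) (s≤s z≤n)

  coeff-≥length : ∀ (xs : List ℤ) {k} → length xs ≤ k → coeff xs k ≡ 0ℤ
  coeff-≥length []       _        = refl
  coeff-≥length (x ∷ xs) (s≤s le) = coeff-≥length xs le

  Deg≤-coeff : ∀ (xs : List ℤ) → Deg≤ (length xs) (coeff xs)
  Deg≤-coeff xs k lt = coeff-≥length xs (ℕP.<⇒≤ lt)

  coeff-applyUpTo : ∀ (f : Seq) {n k} → k < n → coeff (applyUpTo f n) k ≡ f k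
  coeff-applyUpTo f {suc n} {zero}  _         = refl
  coeff-applyUpTo f {suc n} {suc k} (s≤s k<n) = coeff-applyUpTo (f ∘ suc) k<n

  coeff-applyDownFrom : ∀ (f : Seq) {n k} → k < n → coeff (applyDownFrom f n) k ≡ f (n ℕ.∸ suc k)
  coeff-applyDownFrom f {suc n} {zero}  _         = refl
  coeff-applyDownFrom f {suc n} {suc k} (s≤s k<n) = coeff-applyDownFrom f k<n

  coeff-applyUpTo-≗ : ∀ {d f} → Deg≤ d f → coeff (applyUpTo f (suc d)) ≗ f
  coeff-applyUpTo-≗ {d} {f} deg k with k ℕ.≤? d
  ... | yes k≤d = coeff-applyUpTo f (s≤s k≤d)
  ... | no  k≰d = trans (coeff-≥length (applyUpTo f (suc d)) length≤k) (sym (deg k (ℕP.≰⇒> k≰d)))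
    where
    length≤k : length (applyUpTo f (suc d)) ≤ k
    length≤k = ℕP.≤-trans (ℕP.≤-reflexive (ListP.length-applyUpTo f (suc d))) (ℕP.≰⇒> k≰d)

  infixl 6 _⊞_

  _⊞_ : List ℤ → List ℤ → List ℤ
  []       ⊞ ys       = ys
  (x ∷ xs) ⊞ []       = x ∷ xs
  (x ∷ xs) ⊞ (y ∷ ys) = x + y ∷ xs ⊞ ys

  coeff-⊞ : ∀ xs ys → coeff (xs ⊞ ys) ≗ coeff xs ⊕ coeff ys
  coeff-⊞ []       ys       k       = sym (ℤP.+-identityˡ (coeff ys k))
  coeff-⊞ (x ∷ xs) []       k       = sym (ℤP.+-identityʳ (coeff (x ∷ xs) k))
  coeff-⊞ (x ∷ xs) (y ∷ ys) zero    = refl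
  coeff-⊞ (x ∷ xs) (y ∷ ys) (suc k) = coeff-⊞ xs ys k

  coeff-map-neg : ∀ xs → coeff (map -_ xs) ≗ neg (coeff xs)
  coeff-map-neg []       k       = refl
  coeff-map-neg (x ∷ xs) zero    = refl
  coeff-map-neg (x ∷ xs) (suc k) = coeff-map-neg xs k

  rev : ℕ → Seq → Seq
  rev d f k with k ℕ.≤? d
  ... | yes _ = f (d ℕ.∸ k)
  ... | no  _ = 0ℤ

  rev-≤ : ∀ {d k} f → k ≤ d → rev d f k ≡ f (d ℕ.∸ k)
  rev-≤ {d} {k} f k≤d with k ℕ.≤? d
  ... | yes _   = refl
  ... | no  k≰d = ⊥-elim (k≰d k≤d)

  Deg≤-rev : ∀ d f → Deg≤ d (rev d f)
  Deg≤-rev d f k d<k with k ℕ.≤? d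
  ... | yes k≤d = ⊥-elim (ℕP.<⇒≱ d<k k≤d)
  ... | no  _   = refl

  rev-cong : ∀ d {f g} → f ≗ g → rev d f ≗ rev d g
  rev-cong d eq k with k ℕ.≤? d
  ... | yes _ = eq (d ℕ.∸ k)
  ... | no  _ = refl

  rev-⊕ : ∀ d f g → rev d (f ⊕ g) ≗ rev d f ⊕ rev d g
  rev-⊕ d f g k with k ℕ.≤? d
  ... | yes _ = refl
  ... | no  _ = refl

  rev-· : ∀ d c f → rev d (c · f) ≗ c · rev d f
  rev-· d c f k with k ℕ.≤? d
  ... | yes _ = refl
  ... | no  _ = sym (ℤP.*-zeroʳ c)

  rev-involutive : ∀ {d f} → Deg≤ d f → rev d (rev d f) ≗ f
  rev-involutive {d} {f} deg k with k ℕ.≤? d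
  ... | yes k≤d = trans (rev-≤ f (ℕP.m∸n≤m d k)) (cong f (ℕP.m∸[m∸n]≡n k≤d))
  ... | no  k≰d = sym (deg k (ℕP.≰⇒> k≰d))

  rev-X∙ : ∀ d f → rev (suc d) (X∙ f) ≗ rev d f
  rev-X∙ d f k with k ℕ.≤? d
  ... | yes k≤d = trans (rev-≤ (X∙ f) (ℕP.m≤n⇒m≤1+n k≤d)) (cong (X∙ f) (ℕP.+-∸-assoc 1 k≤d))
  ... | no  k≰d with k ℕ.≤? suc d
  ...   | yes k≤1+d = cong (X∙ f) (trans (cong (suc d ℕ.∸_) (ℕP.≤-antisym k≤1+d (ℕP.≰⇒> k≰d))) (ℕP.n∸n≡0 (suc d)))
  ...   | no  _     = refl

  rev-suc : ∀ {d f} → Deg≤ d f → rev (suc d) f ≗ X∙ rev d f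
  rev-suc {d} {f} deg zero    = trans (rev-≤ f z≤n) (deg (suc d) ℕP.≤-refl)
  rev-suc {d} {f} deg (suc k) with k ℕ.≤? d
  ... | yes k≤d = rev-≤ f (s≤s k≤d)
  ... | no  k≰d = Deg≤-rev (suc d) f (suc k) (s≤s (ℕP.≰⇒> k≰d))

  rev-const-⊛ : ∀ a {b} c {g} → Deg≤ b g → rev a (const c) ⊛ rev b g ≗ rev (a ℕ.+ b) (const c ⊛ g)
  rev-const-⊛ zero {b} c {g} degg k = begin
    (rev 0 (const c) ⊛ rev b g) k  ≡⟨ ⊛-congˡ (rev b g) (Deg≤0⇒const (Deg≤-rev 0 (const c))) k ⟩
    (const c ⊛ rev b g) k          ≡⟨ ⊛-constˡ c (rev b g) k ⟩
    c * rev b g k                  ≡⟨ rev-· b c g k ⟨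
    rev b (c · g) k                ≡⟨ rev-cong b (⊛-constˡ c g) k ⟨
    rev b (const c ⊛ g) k          ∎
  rev-const-⊛ (suc a) {b} c {g} degg k = begin
    (rev (suc a) (const c) ⊛ rev b g) k  ≡⟨ ⊛-congˡ (rev b g) (rev-suc (Deg≤-const a c)) k ⟩
    (X∙ rev a (const c) ⊛ rev b g) k     ≡⟨ ⊛-X∙ˡ (rev a (const c)) (rev b g) k ⟩
    (X∙ (rev a (const c) ⊛ rev b g)) k   ≡⟨ X∙-cong (rev-const-⊛ a c degg) k ⟩
    (X∙ rev (a ℕ.+ b) (const c ⊛ g)) k   ≡⟨ rev-suc (Deg≤-⊛ (Deg≤-const a c) degg) k ⟨
    rev (suc a ℕ.+ b) (const c ⊛ g) k    ∎

  rev-⊛ : ∀ a {b f g} → Deg≤ a f → Deg≤ b g → rev a f ⊛ rev b g ≗ rev (a ℕ.+ b) (f ⊛ g)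
  rev-⊛ zero {b} {f} {g} degf degg k = begin
    (rev 0 f ⊛ rev b g) k            ≡⟨ ⊛-congˡ (rev b g) (rev-cong 0 (Deg≤0⇒const degf)) k ⟩
    (rev 0 (const (f 0)) ⊛ rev b g) k ≡⟨ rev-const-⊛ 0 (f 0) degg k ⟩
    rev b (const (f 0) ⊛ g) k         ≡⟨ rev-cong b (⊛-congˡ g (Deg≤0⇒const degf)) k ⟨
    rev b (f ⊛ g) k                   ∎
  rev-⊛ (suc a) {b} {f} {g} degf degg k = begin
    (rev (suc a) f ⊛ rev b g) k
      ≡⟨ ⊛-congˡ (rev b g) (λ i → trans (rev-cong (suc a) (const-⊕-X∙ f) i) (rev-⊕ (suc a) c (X∙ f′) i)) k ⟩
    ((rev (suc a) c ⊕ rev (suc a) (X∙ f′)) ⊛ rev b g) k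
      ≡⟨ ⊛-distribʳ-⊕ (rev (suc a) c) (rev (suc a) (X∙ f′)) (rev b g) k ⟩
    (rev (suc a) c ⊛ rev b g) k + (rev (suc a) (X∙ f′) ⊛ rev b g) k
      ≡⟨ cong₂ _+_ (rev-const-⊛ (suc a) (f 0) degg k) (⊛-congˡ (rev b g) (rev-X∙ a f′) k) ⟩
    rev (suc a ℕ.+ b) (c ⊛ g) k + (rev a f′ ⊛ rev b g) k
      ≡⟨ cong (λ t → rev (suc a ℕ.+ b) (c ⊛ g) k + t) (rev-⊛ a (λ i → degf (suc i) ∘ s≤s) degg k) ⟩
    rev (suc a ℕ.+ b) (c ⊛ g) k + rev (a ℕ.+ b) (f′ ⊛ g) k
      ≡⟨ cong (λ t → rev (suc a ℕ.+ b) (c ⊛ g) k + t) (rev-X∙ (a ℕ.+ b) (f′ ⊛ g) k) ⟨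
    rev (suc a ℕ.+ b) (c ⊛ g) k + rev (suc a ℕ.+ b) (X∙ (f′ ⊛ g)) k
      ≡⟨ rev-⊕ (suc a ℕ.+ b) (c ⊛ g) (X∙ (f′ ⊛ g)) k ⟨
    rev (suc a ℕ.+ b) (c ⊛ g ⊕ X∙ (f′ ⊛ g)) k
      ≡⟨ rev-cong (suc a ℕ.+ b) (⊛-unfoldˡ f g) k ⟨
    rev (suc a ℕ.+ b) (f ⊛ g) k ∎
    where
    c = const (f 0)
    f′ = f ∘ suc

  cofactor-vanish : ∀ {m n e q R} → Deg≤ m q → q m ≢ 0ℤ → Deg≤ n (q ⊛ R) → Deg≤ e R →
                    ∀ j → n < m ℕ.+ j → R j ≡ 0ℤ
  cofactor-vanish {m} {n} {e} {q} {R} degq qm≢0 degp degR j = descend (suc e) j (ℕP.m≤n+m (suc e) j)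
    where
    -- Coefficient m + j of q ⊛ R is q m * R j plus products q i * R j′ with j′ > j.
    descend : ∀ d j → e < j ℕ.+ d → n < m ℕ.+ j → R j ≡ 0ℤ
    descend zero    j e<j+0 _      = degR j (subst (e <_) (ℕP.+-identityʳ j) e<j+0)
    descend (suc d) j e<j+d n<m+j = fromInj₂ (⊥-elim ∘ qm≢0) (ℤP.i*j≡0⇒i≡0∨j≡0 (q m) leading)
      where
      others : ∀ i → i ≤ m ℕ.+ j → i ≢ m → q i * R (m ℕ.+ j ℕ.∸ i) ≡ 0ℤ
      others i _ i≢m with m ℕ.<? i
      ... | yes m<i = trans (cong (_* R (m ℕ.+ j ℕ.∸ i)) (degq i m<i)) (ℤP.*-zeroˡ (R (m ℕ.+ j ℕ.∸ i)))
      ... | no  m≮i = trans (cong (q i *_) (descend d (m ℕ.+ j ℕ.∸ i) e<j′+d n<m+j′)) (ℤP.*-zeroʳ (q i))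
        where
        j<j′ : j < m ℕ.+ j ℕ.∸ i
        j<j′ = subst (j <_) (sym (ℕP.+-∸-comm j (ℕP.≮⇒≥ m≮i)))
                 (ℕP.+-monoˡ-≤ j (ℕP.m<n⇒0<n∸m (ℕP.≤∧≢⇒< (ℕP.≮⇒≥ m≮i) i≢m)))
        e<j′+d : e < (m ℕ.+ j ℕ.∸ i) ℕ.+ d
        e<j′+d = ℕP.<-≤-trans e<j+d (ℕP.≤-trans (ℕP.≤-reflexive (ℕP.+-suc j d)) (ℕP.+-monoˡ-≤ d j<j′))
        n<m+j′ : n < m ℕ.+ (m ℕ.+ j ℕ.∸ i)
        n<m+j′ = ℕP.<-≤-trans n<m+j (ℕP.+-monoʳ-≤ m (ℕP.<⇒≤ j<j′))
      leading : q m * R j ≡ 0ℤ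
      leading = begin
        q m * R j                  ≡⟨ cong (λ t → q m * R t) (ℕP.m+n∸m≡n m j) ⟨
        q m * R (m ℕ.+ j ℕ.∸ m)    ≡⟨ sumTo-single (m ℕ.+ j) _ (ℕP.m≤m+n m j) others ⟨
        (q ⊛ R) (m ℕ.+ j)          ≡⟨ degp (m ℕ.+ j) n<m+j ⟩
        0ℤ                         ∎

  infix 4 _∣ₛ_

  -- coeff q ∣ₛ coeff p is q ∣ₚ p by definition.
  _∣ₛ_ : Seq → Seq → Set
  q ∣ₛ p = ∃[ r ] p ≗ q ⊛ coeff r

  ∣ₛ-resp : ∀ {q q′ p p′} → q ≗ q′ → p ≗ p′ → q ∣ₛ p → q′ ∣ₛ p′
  ∣ₛ-resp q≗q′ p≗p′ (r , p≗qr) = r , λ k → trans (sym (p≗p′ k)) (trans (p≗qr k) (⊛-congˡ (coeff r) q≗q′ k))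

  ∣ₛ-respʳ : ∀ {q p p′} → p ≗ p′ → q ∣ₛ p → q ∣ₛ p′
  ∣ₛ-respʳ {q} = ∣ₛ-resp {q} (λ _ → refl)

  ∣ₛ-⊕ : ∀ {q f g} → q ∣ₛ f → q ∣ₛ g → q ∣ₛ f ⊕ g
  ∣ₛ-⊕ {q} {f} {g} (r , f≗qr) (s , g≗qs) = r ⊞ s , λ k → begin
    f k + g k                          ≡⟨ cong₂ _+_ (f≗qr k) (g≗qs k) ⟩
    (q ⊛ coeff r) k + (q ⊛ coeff s) k  ≡⟨ ⊛-distribˡ-⊕ q (coeff r) (coeff s) k ⟨
    (q ⊛ (coeff r ⊕ coeff s)) k        ≡⟨ ⊛-congʳ q (coeff-⊞ r s) k ⟨
    (q ⊛ coeff (r ⊞ s)) k              ∎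

  ∣ₛ-⊝ : ∀ {q f g} → q ∣ₛ f → q ∣ₛ g → q ∣ₛ f ⊝ g
  ∣ₛ-⊝ {q} {f} {g} q∣f (s , g≗qs) = ∣ₛ-⊕ {q} q∣f (map -_ s , λ k → begin
    - g k                          ≡⟨ cong -_ (g≗qs k) ⟩
    - (q ⊛ coeff s) k              ≡⟨ ⊛-negʳ q (coeff s) k ⟨
    (q ⊛ neg (coeff s)) k          ≡⟨ ⊛-congʳ q (coeff-map-neg s) k ⟨
    (q ⊛ coeff (map -_ s)) k       ∎)

  rev-∣ₛ : ∀ {m n q p} → Deg≤ m q → q m ≢ 0ℤ → Deg≤ n p → p 0 ≢ 0ℤ → q ∣ₛ p → rev m q ∣ₛ rev n p
  rev-∣ₛ {m} {n} {q} {p} degq qm≢0 degp p0≢0 (r , p≗qr) = applyUpTo (rev d R) (suc d) , λ k → begin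
    rev n p k                                          ≡⟨ cong (λ t → rev t p k) (ℕP.m+[n∸m]≡n m≤n) ⟨
    rev (m ℕ.+ d) p k                                  ≡⟨ rev-cong (m ℕ.+ d) p≗qr k ⟩
    rev (m ℕ.+ d) (q ⊛ R) k                            ≡⟨ rev-⊛ m degq degR k ⟨
    (rev m q ⊛ rev d R) k                              ≡⟨ ⊛-congʳ (rev m q) (coeff-applyUpTo-≗ (Deg≤-rev d R)) k ⟨
    (rev m q ⊛ coeff (applyUpTo (rev d R) (suc d))) k  ∎
    where
    R = coeff r
    vanish : ∀ j → n < m ℕ.+ j → R j ≡ 0ℤ
    vanish = cofactor-vanish degq qm≢0 (λ k n<k → trans (sym (p≗qr k)) (degp k n<k)) (Deg≤-coeff r)
    m≤n : m ≤ n
    m≤n = ℕP.≮⇒≥ λ n<m → p0≢0 (begin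
      p 0          ≡⟨ p≗qr 0 ⟩
      q 0 * R 0    ≡⟨ cong (q 0 *_) (vanish 0 (subst (n <_) (sym (ℕP.+-identityʳ m)) n<m)) ⟩
      q 0 * 0ℤ     ≡⟨ ℤP.*-zeroʳ (q 0) ⟩
      0ℤ           ∎)
    d = n ℕ.∸ m
    degR : Deg≤ d R
    degR j d<j = vanish j (subst (_< m ℕ.+ j) (ℕP.m+[n∸m]≡n m≤n) (ℕP.+-monoʳ-< m d<j))

  rev-∣ₛ-⇔ : ∀ {m n q p} → Deg≤ m q → q 0 ≢ 0ℤ → q m ≢ 0ℤ → Deg≤ n p → p 0 ≢ 0ℤ → p n ≢ 0ℤ →
             q ∣ₛ p ⇔ rev m q ∣ₛ rev n p
  rev-∣ₛ-⇔ {m} {n} {q} {p} degq q0≢0 qm≢0 degp p0≢0 pn≢0 = mk⇔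
    (rev-∣ₛ degq qm≢0 degp p0≢0)
    (∣ₛ-resp (rev-involutive degq) (rev-involutive degp) ∘ rev-∣ₛ (Deg≤-rev m q) top≢0 (Deg≤-rev n p) bottom≢0)
    where
    top≢0 : rev m q m ≢ 0ℤ
    top≢0 = q0≢0 ∘ trans (sym (trans (rev-≤ {m} q ℕP.≤-refl) (cong q (ℕP.n∸n≡0 m))))
    bottom≢0 : rev n p 0 ≢ 0ℤ
    bottom≢0 = pn≢0 ∘ trans (sym (rev-≤ {n} p z≤n))

  table : (ℕ → ℕ → ℕ) → ℕ → Seq
  table c n k = + c k n

  Pₛ : ℕ → Seq
  Pₛ = table T

  Qₛ : ℕ → Seq
  Qₛ = table U

  module _ {c : ℕ → ℕ → ℕ} (vanish : ∀ {k n} → n < k → c k n ≡ 0) where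

    Deg≤-table : ∀ n → Deg≤ n (table c n)
    Deg≤-table n k n<k = cong +_ (vanish n<k)

    coeff-table : ∀ n → coeff (map (table c n) (upTo (suc n))) ≗ table c n
    coeff-table n k = trans (cong (λ xs → coeff xs k) (ListP.map-upTo (table c n) (suc n)))
                            (coeff-applyUpTo-≗ (Deg≤-table n) k)

    coeff-reverse-table : ∀ n → coeff (reverse (map (table c n) (upTo (suc n)))) ≗ rev n (table c n)
    coeff-reverse-table n k = trans (cong (λ xs → coeff xs k) as-applyDownFrom) (by-position k)
      where
      as-applyDownFrom : reverse (map (table c n) (upTo (suc n))) ≡ applyDownFrom (table c n) (suc n)
      as-applyDownFrom = begin
        reverse (map (table c n) (upTo (suc n)))   ≡⟨ ListP.reverse-map (table c n) (upTo (suc n)) ⟨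
        map (table c n) (reverse (upTo (suc n)))   ≡⟨ cong (map (table c n)) (ListP.reverse-upTo (suc n)) ⟩
        map (table c n) (downFrom (suc n))         ≡⟨ ListP.map-downFrom (table c n) (suc n) ⟩
        applyDownFrom (table c n) (suc n)          ∎
      by-position : coeff (applyDownFrom (table c n) (suc n)) ≗ rev n (table c n)
      by-position k with ℕP.≤-<-connex k n
      ... | inj₁ k≤n = trans (coeff-applyDownFrom (table c n) (s≤s k≤n)) (sym (rev-≤ (table c n) k≤n))
      ... | inj₂ n<k = trans (coeff-≥length (applyDownFrom (table c n) (suc n)) length≤k)
                             (sym (Deg≤-rev n (table c n) k n<k))
        where
        length≤k : length (applyDownFrom (table c n) (suc n)) ≤ k
        length≤k = ℕP.≤-trans (ℕP.≤-reflexive (ListP.length-applyDownFrom (table c n) (suc n))) n<k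

    table-∣ₚ⇔ : ∀ m n → map (table c m) (upTo (suc m)) ∣ₚ map (table c n) (upTo (suc n)) ⇔ table c m ∣ₛ table c n
    table-∣ₚ⇔ m n = mk⇔ (∣ₛ-resp (coeff-table m) (coeff-table n))
                        (∣ₛ-resp (sym ∘ coeff-table m) (sym ∘ coeff-table n))

    reverse-table-∣ₚ⇔ : (∀ n → c 0 n ≢ 0) → (∀ n → c n n ≢ 0) → ∀ m n →
                        reverse (map (table c m) (upTo (suc m))) ∣ₚ reverse (map (table c n) (upTo (suc n))) ⇔
                        table c m ∣ₛ table c n
    reverse-table-∣ₚ⇔ bottom≢0 top≢0 m n = ⇔-trans
      (mk⇔ (∣ₛ-resp (coeff-reverse-table m) (coeff-reverse-table n))
           (∣ₛ-resp (sym ∘ coeff-reverse-table m) (sym ∘ coeff-reverse-table n)))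
      (⇔-sym (rev-∣ₛ-⇔ (Deg≤-table m) (nonzero (bottom≢0 m)) (nonzero (top≢0 m))
                       (Deg≤-table n) (nonzero (bottom≢0 n)) (nonzero (top≢0 n))))
      where
      nonzero : ∀ {k n} → c k n ≢ 0 → table c n k ≢ 0ℤ
      nonzero c≢0 = c≢0 ∘ ℤP.+-injective

  -- Solutions of F(n+2) = (x+2) F(n+1) - F(n)

  Solution : (ℕ → Seq) → Set
  Solution s = ∀ n → s (2 ℕ.+ n) ≗ [x+2]∙ s (1 ℕ.+ n) ⊝ s n

  table-solution : ∀ {c : ℕ → ℕ → ℕ} →
                   (∀ n → c 0 (2 ℕ.+ n) ℕ.+ c 0 n ≡ 2 ℕ.* c 0 (1 ℕ.+ n)) →
                   (∀ j n → c (suc j) (2 ℕ.+ n) ℕ.+ c (suc j) n ≡ c j (1 ℕ.+ n) ℕ.+ 2 ℕ.* c (suc j) (1 ℕ.+ n)) →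
                   Solution (table c)
  table-solution {c} rec₀ rec₊ n zero    = sum≡⇒difference 0 (c 0 (1 ℕ.+ n)) (rec₀ n)
  table-solution {c} rec₀ rec₊ n (suc j) = sum≡⇒difference (c j (1 ℕ.+ n)) (c (suc j) (1 ℕ.+ n)) (rec₊ j n)

  Pₛ-solution : Solution Pₛ
  Pₛ-solution = table-solution T-rec-zero T-rec-suc

  Qₛ-solution : Solution Qₛ
  Qₛ-solution = table-solution U-rec-zero U-rec-suc

  Pₛ-one : Pₛ 1 ≗ [x+2]∙ Pₛ 0 ⊕ Pₛ 0
  Pₛ-one zero          = refl
  Pₛ-one (suc zero)    = refl
  Pₛ-one (suc (suc k)) = trans (Deg≤-table T-vanish 1 (2 ℕ.+ k) (s≤s (s≤s z≤n)))
    (sym (cong₂ (λ a b → (a + + 2 * b) + b) (Deg≤-table T-vanish 0 (suc k) (s≤s z≤n))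
                                             (Deg≤-table T-vanish 0 (2 ℕ.+ k) (s≤s z≤n))))

  Qₛ-zero : Qₛ 0 ≗ const (+ 2)
  Qₛ-zero zero    = refl
  Qₛ-zero (suc k) = Deg≤-table U-vanish 0 (suc k) (s≤s z≤n)

  Qₛ-one : Qₛ 1 ≗ [x+2]∙ const 1ℤ
  Qₛ-one zero          = refl
  Qₛ-one (suc zero)    = refl
  Qₛ-one (suc (suc k)) = Deg≤-table U-vanish 1 (2 ℕ.+ k) (s≤s (s≤s z≤n))

  solution-unique : ∀ {s t} → Solution s → Solution t → s 0 ≗ t 0 → s 1 ≗ t 1 → ∀ n → s n ≗ t n
  solution-unique {s} {t} sol-s sol-t s₀≗t₀ s₁≗t₁ n = proj₁ (consecutive n)
    where
    step : ∀ n → s n ≗ t n → s (1 ℕ.+ n) ≗ t (1 ℕ.+ n) → s (2 ℕ.+ n) ≗ t (2 ℕ.+ n)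
    step n eqₙ eqₙ₊₁ k = begin
      s (2 ℕ.+ n) k                       ≡⟨ sol-s n k ⟩
      ([x+2]∙ s (1 ℕ.+ n) ⊝ s n) k        ≡⟨ cong₂ (λ a b → a + - b) ([x+2]∙-cong eqₙ₊₁ k) (eqₙ k) ⟩
      ([x+2]∙ t (1 ℕ.+ n) ⊝ t n) k        ≡⟨ sol-t n k ⟨
      t (2 ℕ.+ n) k                       ∎
    consecutive : ∀ n → s n ≗ t n × s (suc n) ≗ t (suc n)
    consecutive zero    = s₀≗t₀ , s₁≗t₁
    consecutive (suc n) = proj₂ (consecutive n) , step n (proj₁ (consecutive n)) (proj₂ (consecutive n))

  solution-⊕ : ∀ {s t} → Solution s → Solution t → Solution (λ n → s n ⊕ t n)
  solution-⊕ {s} {t} sol-s sol-t n k = begin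
    s (2 ℕ.+ n) k + t (2 ℕ.+ n) k
      ≡⟨ cong₂ _+_ (sol-s n k) (sol-t n k) ⟩
    ([x+2]∙ s (1 ℕ.+ n) ⊝ s n) k + ([x+2]∙ t (1 ℕ.+ n) ⊝ t n) k
      ≡⟨ regroup (([x+2]∙ s (1 ℕ.+ n)) k) (s n k) (([x+2]∙ t (1 ℕ.+ n)) k) (t n k) ⟩
    (([x+2]∙ s (1 ℕ.+ n)) k + ([x+2]∙ t (1 ℕ.+ n)) k) + - (s n k + t n k)
      ≡⟨ cong (λ a → a + - (s n k + t n k)) ([x+2]∙-⊕ (s (1 ℕ.+ n)) (t (1 ℕ.+ n)) k) ⟨
    ([x+2]∙ (s (1 ℕ.+ n) ⊕ t (1 ℕ.+ n)) ⊝ (s n ⊕ t n)) k ∎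
    where
    regroup : ∀ a b c d → (a + - b) + (c + - d) ≡ (a + c) + - (b + d)
    regroup = solve-∀

  solution-⊛ : ∀ f {s} → Solution s → Solution (λ n → f ⊛ s n)
  solution-⊛ f {s} sol n k = begin
    (f ⊛ s (2 ℕ.+ n)) k                        ≡⟨ ⊛-congʳ f (sol n) k ⟩
    (f ⊛ ([x+2]∙ s (1 ℕ.+ n) ⊝ s n)) k         ≡⟨ ⊛-distribˡ-⊝ f ([x+2]∙ s (1 ℕ.+ n)) (s n) k ⟩
    (f ⊛ [x+2]∙ s (1 ℕ.+ n) ⊝ f ⊛ s n) k       ≡⟨ cong (λ a → a + - (f ⊛ s n) k) (⊛-[x+2]∙ʳ f (s (1 ℕ.+ n)) k) ⟩
    ([x+2]∙ (f ⊛ s (1 ℕ.+ n)) ⊝ f ⊛ s n) k     ∎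

  Solutionℤ : (ℤ → Seq) → Set
  Solutionℤ S = ∀ i → S (ℤ.suc (ℤ.suc i)) ≗ [x+2]∙ S (ℤ.suc i) ⊝ S i

  private
    ∣m⊖[m+i]∣≡i : ∀ m i → ℤ.∣ m ⊖ (m ℕ.+ i) ∣ ≡ i
    ∣m⊖[m+i]∣≡i m i = trans (ℤP.∣⊖∣-≤ (ℕP.m≤m+n m i)) (ℕP.m+n∸m≡n m i)

    at : ∀ {A : Set} (S : A → Seq) {i j} → i ≡ j → S i ≗ S j
    at S eq k = cong (λ i → S i k) eq

    solve-for-last : ∀ {a b c} → a ≡ b + - c → c ≡ b + - a
    solve-for-last {a} {b} {c} eq = trans (involution b c) (cong (λ t → b + - t) (sym eq))
      where
      involution : ∀ b c → c ≡ b + - (b + - c)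
      involution = solve-∀

  solution-forward : ∀ {S} → Solutionℤ S → ∀ j → Solution (λ n → S (j + + n))
  solution-forward {S} sol j n k = begin
    S (j + + (2 ℕ.+ n)) k                                    ≡⟨ at S (two-up j (+ n)) k ⟩
    S (ℤ.suc (ℤ.suc (j + + n))) k                            ≡⟨ sol (j + + n) k ⟩
    ([x+2]∙ S (ℤ.suc (j + + n)) ⊝ S (j + + n)) k
      ≡⟨ cong (λ a → a + - S (j + + n) k) ([x+2]∙-cong (at S (one-up j (+ n))) k) ⟩
    ([x+2]∙ S (j + + (1 ℕ.+ n)) ⊝ S (j + + n)) k             ∎
    where
    two-up : ∀ j x → j + (1ℤ + (1ℤ + x)) ≡ 1ℤ + (1ℤ + (j + x))
    two-up = solve-∀
    one-up : ∀ j x → 1ℤ + (j + x) ≡ j + (1ℤ + x)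
    one-up = solve-∀

  solution-backward : ∀ {S} → Solutionℤ S → ∀ j → Solution (λ n → S (j - + n))
  solution-backward {S} sol j n k = solve-for-last {b = ([x+2]∙ S (j - + (1 ℕ.+ n))) k} (begin
    S (j - + n) k                                            ≡⟨ at S (two-down j (+ n)) k ⟨
    S (ℤ.suc (ℤ.suc (j - + (2 ℕ.+ n)))) k                    ≡⟨ sol (j - + (2 ℕ.+ n)) k ⟩
    ([x+2]∙ S (ℤ.suc (j - + (2 ℕ.+ n))) ⊝ S (j - + (2 ℕ.+ n))) k
      ≡⟨ cong (λ a → a + - S (j - + (2 ℕ.+ n)) k) ([x+2]∙-cong (at S (one-down j (+ n))) k) ⟩
    ([x+2]∙ S (j - + (1 ℕ.+ n)) ⊝ S (j - + (2 ℕ.+ n))) k     ∎)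
    where
    two-down : ∀ j x → 1ℤ + (1ℤ + (j - (1ℤ + (1ℤ + x)))) ≡ j - x
    two-down = solve-∀
    one-down : ∀ j x → 1ℤ + (j - (1ℤ + (1ℤ + x))) ≡ j - (1ℤ + x)
    one-down = solve-∀

  -- Both sides solve the recurrence in n, and they agree for n = 0 and n = 1.
  chebyshev : ∀ {S} → Solutionℤ S → ∀ j n → S (j + + n) ⊕ S (j - + n) ≗ S j ⊛ Qₛ n
  chebyshev {S} sol j = solution-unique
    (solution-⊕ (solution-forward sol j) (solution-backward sol j)) (solution-⊛ (S j) Qₛ-solution) base₀ base₁
    where
    base₀ : S (j + + 0) ⊕ S (j - + 0) ≗ S j ⊛ Qₛ 0
    base₀ k = begin
      S (j + + 0) k + S (j - + 0) k  ≡⟨ cong₂ _+_ (at S (ℤP.+-identityʳ j) k) (at S (ℤP.+-identityʳ j) k) ⟩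
      S j k + S j k                  ≡⟨ double (S j k) ⟩
      + 2 * S j k                    ≡⟨ ⊛-constʳ (S j) (+ 2) k ⟨
      (S j ⊛ const (+ 2)) k          ≡⟨ ⊛-congʳ (S j) Qₛ-zero k ⟨
      (S j ⊛ Qₛ 0) k                 ∎
      where
      double : ∀ a → a + a ≡ + 2 * a
      double = solve-∀
    base₁ : S (j + + 1) ⊕ S (j - + 1) ≗ S j ⊛ Qₛ 1
    base₁ k = begin
      S (j + + 1) k + S (j - + 1) k
        ≡⟨ cong (λ a → a + S (j - + 1) k) (trans (at S (up j) k) (sol (j - + 1) k)) ⟩
      (([x+2]∙ S (ℤ.suc (j - + 1))) k + - S (j - + 1) k) + S (j - + 1) k
        ≡⟨ sub-add (([x+2]∙ S (ℤ.suc (j - + 1))) k) (S (j - + 1) k) ⟩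
      ([x+2]∙ S (ℤ.suc (j - + 1))) k
        ≡⟨ [x+2]∙-cong (at S (down j)) k ⟩
      ([x+2]∙ S j) k
        ≡⟨ [x+2]∙-cong (λ i → trans (⊛-constʳ (S j) 1ℤ i) (ℤP.*-identityˡ (S j i))) k ⟨
      ([x+2]∙ (S j ⊛ const 1ℤ)) k
        ≡⟨ ⊛-[x+2]∙ʳ (S j) (const 1ℤ) k ⟨
      (S j ⊛ [x+2]∙ const 1ℤ) k
        ≡⟨ ⊛-congʳ (S j) Qₛ-one k ⟨
      (S j ⊛ Qₛ 1) k ∎
      where
      up : ∀ j → j + 1ℤ ≡ 1ℤ + (1ℤ + (j - 1ℤ))
      up = solve-∀
      down : ∀ j → 1ℤ + (j - 1ℤ) ≡ j
      down = solve-∀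
      sub-add : ∀ a b → (a + - b) + b ≡ a
      sub-add = solve-∀

  -- P(-1-n) = -P(n) and Q(-n) = Q(n) keep the recurrence valid on all of ℤ.
  Pℤ : ℤ → Seq
  Pℤ (+ n)    = Pₛ n
  Pℤ -[1+ n ] = neg (Pₛ n)

  Pℤ-solution : Solutionℤ Pℤ
  Pℤ-solution (+ n)              = Pₛ-solution n
  Pℤ-solution -[1+ 0 ]           k =
    trans (Pₛ-one k) (cong (λ t → ([x+2]∙ Pₛ 0) k + t) (sym (ℤP.neg-involutive (Pₛ 0 k))))
  Pℤ-solution -[1+ 1 ]           k = trans (cancel (([x+2]∙ Pₛ 0) k) (Pₛ 0 k))
    (sym (cong₂ (λ a b → a + - - b) ([x+2]∙-neg (Pₛ 0) k) (Pₛ-one k)))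
    where
    cancel : ∀ a b → b ≡ - a + - - (a + b)
    cancel = solve-∀
  Pℤ-solution -[1+ suc (suc n) ] k = trans (cancel (([x+2]∙ Pₛ (1 ℕ.+ n)) k) (- Pₛ n k))
    (sym (cong₂ (λ a b → a + - - b) ([x+2]∙-neg (Pₛ (1 ℕ.+ n)) k) (Pₛ-solution n k)))
    where
    cancel : ∀ a b → b ≡ - a + - - (a + b)
    cancel = solve-∀

  Qℤ : ℤ → Seq
  Qℤ (+ n)    = Qₛ n
  Qℤ -[1+ n ] = Qₛ (suc n)

  Qℤ-solution : Solutionℤ Qℤ
  Qℤ-solution (+ n)              = Qₛ-solution n
  Qℤ-solution -[1+ 0 ]           k = begin
    Qₛ 1 k                                                     ≡⟨ Qₛ-one k ⟩
    ([x+2]∙ const 1ℤ) k                                        ≡⟨ twice k ⟩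
    ([x+2]∙ const (+ 2)) k + - ([x+2]∙ const 1ℤ) k
      ≡⟨ cong₂ (λ a b → a + - b) ([x+2]∙-cong Qₛ-zero k) (Qₛ-one k) ⟨
    ([x+2]∙ Qₛ 0) k + - Qₛ 1 k                                 ∎
    where
    twice : ∀ k → ([x+2]∙ const 1ℤ) k ≡ ([x+2]∙ const (+ 2)) k + - ([x+2]∙ const 1ℤ) k
    twice zero          = refl
    twice (suc zero)    = refl
    twice (suc (suc k)) = refl
  Qℤ-solution -[1+ suc zero ]    k = solve-for-last {b = ([x+2]∙ Qₛ 1) k} (Qₛ-solution 0 k)
  Qℤ-solution -[1+ suc (suc n) ] k = solve-for-last {b = ([x+2]∙ Qₛ (2 ℕ.+ n)) k} (Qₛ-solution (suc n) k)

  Qℤ-abs : ∀ i → Qℤ i ≡ Qₛ ℤ.∣ i ∣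
  Qℤ-abs (+ n)    = refl
  Qℤ-abs -[1+ n ] = refl

  Pₛ-step : ∀ m i → Pₛ (m ℕ.+ suc (m ℕ.+ i)) ≗ Pₛ m ⊛ Qₛ (suc (m ℕ.+ i)) ⊕ Pₛ i
  Pₛ-step m i k = move (trans (cong (λ t → Pₛ (m ℕ.+ suc (m ℕ.+ i)) k + t) (sym (at Pℤ below k)))
                              (chebyshev Pℤ-solution (+ m) (suc (m ℕ.+ i)) k))
    where
    below : + m - + suc (m ℕ.+ i) ≡ -[1+ i ]
    below = begin
      + m - + suc (m ℕ.+ i)         ≡⟨ ℤP.[+m]-[+n]≡m⊖n m (suc (m ℕ.+ i)) ⟩
      m ⊖ suc (m ℕ.+ i)             ≡⟨ cong₂ _⊖_ (ℕP.+-identityʳ m) (ℕP.+-suc m i) ⟨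
      (m ℕ.+ 0) ⊖ (m ℕ.+ suc i)     ≡⟨ ℤP.+-cancelˡ-⊖ m 0 (suc i) ⟩
      -[1+ i ]                      ∎
    move : ∀ {a b c} → a + - b ≡ c → a ≡ c + b
    move {a} {b} refl = sub-add a b
      where
      sub-add : ∀ a b → a ≡ (a + - b) + b
      sub-add = solve-∀

  Qₛ-sum : ∀ m r → Qₛ (m ℕ.+ r) ⊕ Qₛ ℤ.∣ m ⊖ r ∣ ≗ Qₛ m ⊛ Qₛ r
  Qₛ-sum m r k = trans (cong (λ t → Qₛ (m ℕ.+ r) k + t) difference) (chebyshev Qℤ-solution (+ m) r k)
    where
    difference : Qₛ ℤ.∣ m ⊖ r ∣ k ≡ Qℤ (+ m - + r) k
    difference = sym (trans (at Qℤ (ℤP.[+m]-[+n]≡m⊖n m r) k) (cong (λ S → S k) (Qℤ-abs (m ⊖ r))))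

  Qₛ-step : ∀ m i → Qₛ (m ℕ.+ (m ℕ.+ i)) ≗ Qₛ m ⊛ Qₛ (m ℕ.+ i) ⊝ Qₛ i
  Qₛ-step m i k =
    move (trans (cong (λ t → Qₛ (m ℕ.+ (m ℕ.+ i)) k + Qₛ t k) (sym (∣m⊖[m+i]∣≡i m i))) (Qₛ-sum m (m ℕ.+ i) k))
    where
    move : ∀ {a b c} → a + b ≡ c → a ≡ c + - b
    move {a} {b} refl = add-sub a b
      where
      add-sub : ∀ a b → a ≡ (a + b) + - b
      add-sub = solve-∀

  ∣ₛ-refl : ∀ {q} → q ∣ₛ q
  ∣ₛ-refl {q} = 1ℤ ∷ [] , λ k → sym (trans (⊛-congʳ q one k) (trans (⊛-constʳ q 1ℤ k) (ℤP.*-identityˡ (q k))))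
    where
    one : coeff (1ℤ ∷ []) ≗ const 1ℤ
    one zero    = refl
    one (suc k) = refl

  ∣ₛ-⊛Qₛ : ∀ q n → q ∣ₛ q ⊛ Qₛ n
  ∣ₛ-⊛Qₛ q n = Q n , ⊛-congʳ q (sym ∘ coeff-table U-vanish n)

  Pₛ-∣ₛ : ∀ m t → Pₛ m ∣ₛ Pₛ (m ℕ.+ t ℕ.* (2 ℕ.* m ℕ.+ 1))
  Pₛ-∣ₛ m zero    = ∣ₛ-respʳ {Pₛ m} (at Pₛ (sym (ℕP.+-identityʳ m))) ∣ₛ-refl
  Pₛ-∣ₛ m (suc t) = ∣ₛ-respʳ {Pₛ m} (λ k → trans (sym (Pₛ-step m i k)) (at Pₛ (sym (reindex m t)) k))
                            (∣ₛ-⊕ {Pₛ m} (∣ₛ-⊛Qₛ (Pₛ m) (suc (m ℕ.+ i))) (Pₛ-∣ₛ m t))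
    where
    i = m ℕ.+ t ℕ.* (2 ℕ.* m ℕ.+ 1)
    reindex : ∀ m t → m ℕ.+ suc t ℕ.* (2 ℕ.* m ℕ.+ 1) ≡ m ℕ.+ suc (m ℕ.+ (m ℕ.+ t ℕ.* (2 ℕ.* m ℕ.+ 1)))
    reindex = ℕSolver.solve-∀

  Qₛ-∣ₛ : ∀ m t → Qₛ m ∣ₛ Qₛ (m ℕ.+ t ℕ.* (2 ℕ.* m))
  Qₛ-∣ₛ m zero    = ∣ₛ-respʳ {Qₛ m} (at Qₛ (sym (ℕP.+-identityʳ m))) ∣ₛ-refl
  Qₛ-∣ₛ m (suc t) = ∣ₛ-respʳ {Qₛ m} (λ k → trans (sym (Qₛ-step m i k)) (at Qₛ (sym (reindex m t)) k))
                            (∣ₛ-⊝ {Qₛ m} (∣ₛ-⊛Qₛ (Qₛ m) (m ℕ.+ i)) (Qₛ-∣ₛ m t))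
    where
    i = m ℕ.+ t ℕ.* (2 ℕ.* m)
    reindex : ∀ m t → m ℕ.+ suc t ℕ.* (2 ℕ.* m) ≡ m ℕ.+ (m ℕ.+ (m ℕ.+ t ℕ.* (2 ℕ.* m)))
    reindex = ℕSolver.solve-∀

  -- Evaluation at 0 and at 1

  ∣ₛ⇒∣-at-0 : ∀ {q p} → q ∣ₛ p → ℤ.∣ q 0 ∣ ∣ ℤ.∣ p 0 ∣
  ∣ₛ⇒∣-at-0 {q} (r , p≗qr) =
    divides ℤ.∣ coeff r 0 ∣ (trans (cong ℤ.∣_∣ (p≗qr 0))
                             (trans (ℤP.abs-* (q 0) (coeff r 0)) (ℕP.*-comm ℤ.∣ q 0 ∣ ℤ.∣ coeff r 0 ∣)))

  sumTo-extend : ∀ {d f} → Deg≤ d f → ∀ {e} → d ≤ e → sumTo e f ≡ sumTo d f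
  sumTo-extend {d} {f} deg {e} d≤e = subst (λ e → sumTo e f ≡ sumTo d f) (ℕP.m∸n+n≡m d≤e) (extra (e ℕ.∸ d))
    where
    extra : ∀ k → sumTo (k ℕ.+ d) f ≡ sumTo d f
    extra zero    = refl
    extra (suc k) = trans (cong₂ _+_ (extra k) (deg (suc (k ℕ.+ d)) (s≤s (ℕP.m≤n+m d k)))) (ℤP.+-identityʳ _)

  sumTo-⊛ : ∀ a {b f g} → Deg≤ a f → Deg≤ b g → sumTo (a ℕ.+ b) (f ⊛ g) ≡ sumTo a f * sumTo b g
  sumTo-⊛ zero {b} {f} {g} degf degg =
    trans (sumTo-cong b (λ i _ → trans (⊛-congˡ g (Deg≤0⇒const degf) i) (⊛-constˡ (f 0) g i))) (sumTo-* b (f 0) g)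
  sumTo-⊛ (suc a) {b} {f} {g} degf degg = begin
    sumTo (suc a ℕ.+ b) (f ⊛ g)
      ≡⟨ sumTo-cong (suc a ℕ.+ b) (λ i _ → trans (⊛-unfoldˡ f g i) (cong (_+ (X∙ (f′ ⊛ g)) i) (⊛-constˡ (f 0) g i))) ⟩
    sumTo (suc a ℕ.+ b) (f 0 · g ⊕ X∙ (f′ ⊛ g))
      ≡⟨ sumTo-+ (suc a ℕ.+ b) (f 0 · g) (X∙ (f′ ⊛ g)) ⟩
    sumTo (suc a ℕ.+ b) (f 0 · g) + sumTo (suc a ℕ.+ b) (X∙ (f′ ⊛ g))
      ≡⟨ cong₂ _+_ (sumTo-* (suc a ℕ.+ b) (f 0) g) (trans (sumTo-suc (a ℕ.+ b) (X∙ (f′ ⊛ g))) (ℤP.+-identityˡ _)) ⟩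
    f 0 * sumTo (suc a ℕ.+ b) g + sumTo (a ℕ.+ b) (f′ ⊛ g)
      ≡⟨ cong₂ (λ x y → f 0 * x + y) (sumTo-extend degg (ℕP.m≤n+m b (suc a)))
                                      (sumTo-⊛ a (λ i → degf (suc i) ∘ s≤s) degg) ⟩
    f 0 * sumTo b g + sumTo a f′ * sumTo b g
      ≡⟨ ℤP.*-distribʳ-+ (sumTo b g) (f 0) (sumTo a f′) ⟨
    (f 0 + sumTo a f′) * sumTo b g
      ≡⟨ cong (_* sumTo b g) (sumTo-suc a f) ⟨
    sumTo (suc a) f * sumTo b g ∎
    where
    f′ = f ∘ suc

  ∣ₛ⇒∣-at-1 : ∀ {m n q p} → Deg≤ m q → Deg≤ n p → q ∣ₛ p → ℤ.∣ sumTo m q ∣ ∣ ℤ.∣ sumTo n p ∣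
  ∣ₛ⇒∣-at-1 {m} {n} {q} {p} degq degp (r , p≗qr) =
    divides ℤ.∣ sumTo ℓ R ∣ (trans (cong ℤ.∣_∣ value)
                             (trans (ℤP.abs-* (sumTo m q) (sumTo ℓ R)) (ℕP.*-comm ℤ.∣ sumTo m q ∣ ℤ.∣ sumTo ℓ R ∣)))
    where
    R = coeff r
    ℓ = length r
    e = n ℕ.+ (m ℕ.+ ℓ)
    value : sumTo n p ≡ sumTo m q * sumTo ℓ R
    value = begin
      sumTo n p              ≡⟨ sumTo-extend degp (ℕP.m≤m+n n (m ℕ.+ ℓ)) ⟨
      sumTo e p              ≡⟨ sumTo-cong e (λ k _ → p≗qr k) ⟩
      sumTo e (q ⊛ R)        ≡⟨ sumTo-extend (Deg≤-⊛ degq (Deg≤-coeff r)) (ℕP.m≤n+m (m ℕ.+ ℓ) n) ⟩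
      sumTo (m ℕ.+ ℓ) (q ⊛ R) ≡⟨ sumTo-⊛ m degq (Deg≤-coeff r) ⟩
      sumTo m q * sumTo ℓ R  ∎

  Q-at-1 : ℕ → ℕ
  Q-at-1 n = sum (applyUpTo (λ k → U k n) (suc n))

  sumTo-Qₛ : ∀ n → sumTo n (Qₛ n) ≡ + Q-at-1 n
  sumTo-Qₛ n = sumTo-pos n (λ k → U k n)
    where
    sumTo-pos : ∀ k (f : ℕ → ℕ) → sumTo k (λ i → + f i) ≡ + sum (applyUpTo f (suc k))
    sumTo-pos zero    f = cong +_ (sym (ℕP.+-identityʳ (f 0)))
    sumTo-pos (suc k) f = trans (sumTo-suc k (λ i → + f i)) (cong (λ t → + f 0 + t) (sumTo-pos k (f ∘ suc)))

  Q-at-1-sum : ∀ m r → Q-at-1 (m ℕ.+ r) ℕ.+ Q-at-1 ℤ.∣ m ⊖ r ∣ ≡ Q-at-1 m ℕ.* Q-at-1 r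
  Q-at-1-sum m r = ℤP.+-injective (begin
    + Q-at-1 (m ℕ.+ r) + + Q-at-1 d                   ≡⟨ cong₂ _+_ (sumTo-Qₛ (m ℕ.+ r)) (sumTo-Qₛ d) ⟨
    sumTo (m ℕ.+ r) (Qₛ (m ℕ.+ r)) + sumTo d (Qₛ d)   ≡⟨ cong₂ _+_ (sumTo-extend (degQ (m ℕ.+ r)) (ℕP.m≤m+n (m ℕ.+ r) d))
                                                                  (sumTo-extend (degQ d) (ℕP.m≤n+m d (m ℕ.+ r))) ⟨
    sumTo e (Qₛ (m ℕ.+ r)) + sumTo e (Qₛ d)           ≡⟨ sumTo-+ e (Qₛ (m ℕ.+ r)) (Qₛ d) ⟨
    sumTo e (Qₛ (m ℕ.+ r) ⊕ Qₛ d)                     ≡⟨ sumTo-cong e (λ k _ → Qₛ-sum m r k) ⟩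
    sumTo e (Qₛ m ⊛ Qₛ r)                             ≡⟨ sumTo-extend (Deg≤-⊛ (degQ m) (degQ r)) (ℕP.m≤m+n (m ℕ.+ r) d) ⟩
    sumTo (m ℕ.+ r) (Qₛ m ⊛ Qₛ r)                     ≡⟨ sumTo-⊛ m (degQ m) (degQ r) ⟩
    sumTo m (Qₛ m) * sumTo r (Qₛ r)                   ≡⟨ cong₂ _*_ (sumTo-Qₛ m) (sumTo-Qₛ r) ⟩
    + Q-at-1 m * + Q-at-1 r                           ≡⟨ ℤP.pos-* (Q-at-1 m) (Q-at-1 r) ⟨
    + (Q-at-1 m ℕ.* Q-at-1 r)                         ∎)
    where
    degQ = Deg≤-table U-vanish
    d = ℤ.∣ m ⊖ r ∣
    e = (m ℕ.+ r) ℕ.+ d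

  Q-at-1-sum-≤ : ∀ {m r} → r ≤ m → Q-at-1 (m ℕ.+ r) ℕ.+ Q-at-1 (m ℕ.∸ r) ≡ Q-at-1 m ℕ.* Q-at-1 r
  Q-at-1-sum-≤ {m} {r} r≤m =
    trans (cong (λ d → Q-at-1 (m ℕ.+ r) ℕ.+ Q-at-1 d) (sym (cong ℤ.∣_∣ (ℤP.⊖-≥ r≤m)))) (Q-at-1-sum m r)

  Q-at-1-sum-≥ : ∀ m i → Q-at-1 (m ℕ.+ (m ℕ.+ i)) ℕ.+ Q-at-1 i ≡ Q-at-1 m ℕ.* Q-at-1 (m ℕ.+ i)
  Q-at-1-sum-≥ m i =
    trans (cong (λ d → Q-at-1 (m ℕ.+ (m ℕ.+ i)) ℕ.+ Q-at-1 d) (sym (∣m⊖[m+i]∣≡i m i))) (Q-at-1-sum m (m ℕ.+ i))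

  Qₛ-∣ₛ⇒Q-at-1-∣ : ∀ {m n} → Qₛ m ∣ₛ Qₛ n → Q-at-1 m ∣ Q-at-1 n
  Qₛ-∣ₛ⇒Q-at-1-∣ {m} {n} Qₘ∣Qₙ = subst₂ _∣_ (cong ℤ.∣_∣ (sumTo-Qₛ m)) (cong ℤ.∣_∣ (sumTo-Qₛ n))
    (∣ₛ⇒∣-at-1 (Deg≤-table U-vanish m) (Deg≤-table U-vanish n) Qₘ∣Qₙ)

open import Data.Nat using (_+_; _*_; _∸_; _^_; _/_; _%_; NonZero; >-nonZero)
open import Data.Nat.DivMod using (m≡m%n+[m/n]*n; m%n<n)
open import Data.Nat.Divisibility
  using (_∣_; divides; _∣0; n∣n; >⇒∤; ∣m+n∣m⇒∣n; ∣m∣n⇒∣m+n; ∣1⇒≡1; ∣m⇒∣m*n; ∣n⇒∣m*n; m∣m*n; n∣m*n; m%n≡0⇔n∣m)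
open import Data.Nat.Coprimality using (Coprime; coprime-divisor)
open import Data.Nat.Tactic.RingSolver using (solve-∀)
open import Data.Product using (_×_; _,_; ∃-syntax)
open import Data.Sum using (_⊎_; inj₁; inj₂)
open import Data.Empty using (⊥; ⊥-elim)
open import Function using (_∘_; _⇔_; mk⇔; Equivalence)
open import Function.Properties.Equivalence using () renaming (trans to ⇔-trans; sym to ⇔-sym)
open import Relation.Binary using (tri<; tri≈; tri>)

≡⇒⇔ : ∀ (P : ℕ → Set) {i j} → i ≡ j → P i ⇔ P j
≡⇒⇔ P i≡j = mk⇔ (subst P i≡j) (subst P (sym i≡j))

∣-+-⇔ : ∀ {d a b} → d ∣ a → (d ∣ a + b ⇔ d ∣ b)
∣-+-⇔ d∣a = mk⇔ (λ d∣a+b → ∣m+n∣m⇒∣n d∣a+b d∣a) (∣m∣n⇒∣m+n d∣a)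

∣-sum-⇔ : ∀ {d a b} → d ∣ a + b → (d ∣ a ⇔ d ∣ b)
∣-sum-⇔ {d} {a} {b} d∣a+b = mk⇔ (∣m+n∣m⇒∣n d∣a+b) (∣m+n∣m⇒∣n (subst (d ∣_) (ℕP.+-comm a b) d∣a+b))

periodic : ∀ (P : ℕ → Set) {A} → (∀ j → P (j + A) ⇔ P j) → ∀ q r → P (r + q * A) ⇔ P r
periodic P     shift zero    r = ≡⇒⇔ P (ℕP.+-identityʳ r)
periodic P {A} shift (suc q) r =
  ⇔-trans (≡⇒⇔ P (regroup r q A)) (⇔-trans (shift (r + q * A)) (periodic P shift q r))
  where
  regroup : ∀ r q A → r + suc q * A ≡ (r + q * A) + A
  regroup = solve-∀

strictMono-from-step : ∀ {f : ℕ → ℕ} → (∀ n → f n < f (suc n)) → ∀ {i j} → i < j → f i < f j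
strictMono-from-step step {i} {suc j} (s≤s i≤j) with ℕP.m≤n⇒m<n∨m≡n i≤j
... | inj₁ i<j  = ℕP.<-trans (strictMono-from-step step i<j) (step j)
... | inj₂ refl = step i

even-or-odd : ∀ q → (∃[ t ] q ≡ 2 * t) ⊎ (∃[ t ] q ≡ 2 * t + 1)
even-or-odd zero = inj₁ (0 , refl)
even-or-odd (suc q) with even-or-odd q
... | inj₁ (t , refl) = inj₂ (t , ℕP.+-comm 1 (2 * t))
... | inj₂ (t , refl) = inj₁ (suc t , reindex t)
  where
  reindex : ∀ t → suc (2 * t + 1) ≡ 2 * suc t
  reindex = solve-∀

odd-quotient : ∀ {m n c} → 2 * n + 1 ≡ c * (2 * m + 1) → ∃[ t ] n ≡ m + t * (2 * m + 1)
odd-quotient {m} {n} {c} eq with even-or-odd c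
... | inj₁ (t , refl) = ⊥-elim (ℕP.even≢odd (t * (2 * m + 1)) n (begin
  2 * (t * (2 * m + 1))  ≡⟨ ℕP.*-assoc 2 t (2 * m + 1) ⟨
  2 * t * (2 * m + 1)    ≡⟨ eq ⟨
  2 * n + 1              ≡⟨ ℕP.+-comm (2 * n) 1 ⟩
  suc (2 * n)            ∎))
  where open ≡-Reasoning
... | inj₂ (t , refl) = t , ℕP.*-cancelˡ-≡ n _ 2 (ℕP.+-cancelʳ-≡ 1 _ _ (trans eq (expand t m)))
  where
  expand : ∀ t m → (2 * t + 1) * (2 * m + 1) ≡ 2 * (m + t * (2 * m + 1)) + 1
  expand = solve-∀

P-divisibility : ∀ m n → (2 * m + 1 ∣ 2 * n + 1) ⇔ Pₛ m ∣ₛ Pₛ n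
P-divisibility m n = mk⇔ forward (subst₂ _∣_ (T-const m) (T-const n) ∘ ∣ₛ⇒∣-at-0 {Pₛ m} {Pₛ n})
  where
  forward : 2 * m + 1 ∣ 2 * n + 1 → Pₛ m ∣ₛ Pₛ n
  forward (divides c eq) with odd-quotient {m} {n} {c} eq
  ... | t , n≡ = subst (λ k → Pₛ m ∣ₛ Pₛ k) (sym n≡) (Pₛ-∣ₛ m t)

-- Divisibility among the values Q_n(1)

Q-at-1-< : ∀ n → Q-at-1 n < Q-at-1 (suc n)
Q-at-1-< zero    = ℕP.n<1+n 2
Q-at-1-< (suc n) = ℕP.≤-<-trans (ℕP.m≤m+n w₁ w₁) (ℕP.+-cancelʳ-< w₁ (w₁ + w₁) w₂ (begin-strict
  (w₁ + w₁) + w₁           ≡⟨ thrice w₁ ⟩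
  w₁ * 3                   ≡⟨ Q-at-1-sum-≤ {suc n} {1} (s≤s z≤n) ⟨
  Q-at-1 (suc n + 1) + w₀  ≡⟨ cong (λ k → Q-at-1 k + w₀) (ℕP.+-comm (suc n) 1) ⟩
  w₂ + w₀                  <⟨ ℕP.+-monoʳ-< w₂ (Q-at-1-< n) ⟩
  w₂ + w₁                  ∎))
  where
  open ℕP.≤-Reasoning
  w₀ = Q-at-1 n
  w₁ = Q-at-1 (suc n)
  w₂ = Q-at-1 (2 + n)
  thrice : ∀ a → (a + a) + a ≡ a * 3
  thrice = solve-∀

Q-at-1-pos : ∀ n → 0 < Q-at-1 n
Q-at-1-pos zero    = s≤s z≤n
Q-at-1-pos (suc n) = ℕP.<-trans (Q-at-1-pos n) (Q-at-1-< n)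

Q-at-1-period : ∀ m j → Q-at-1 m ∣ Q-at-1 (j + 2 * m) ⇔ Q-at-1 m ∣ Q-at-1 j
Q-at-1-period m j = ∣-sum-⇔ (subst (Q-at-1 m ∣_) identity (m∣m*n (Q-at-1 (m + j))))
  where
  reindex : ∀ j m → m + (m + j) ≡ j + 2 * m
  reindex = solve-∀
  identity : Q-at-1 m * Q-at-1 (m + j) ≡ Q-at-1 (j + 2 * m) + Q-at-1 j
  identity = sym (trans (cong (λ k → Q-at-1 k + Q-at-1 j) (sym (reindex j m))) (Q-at-1-sum-≥ m j))

Q-at-1-residue : ∀ {m k} → k < 2 * m → Q-at-1 m ∣ Q-at-1 k → k ≡ m
Q-at-1-residue {m} {k} k<2m D∣wₖ with ℕP.<-cmp k m
... | tri< k<m _ _ = ⊥-elim (>⇒∤ {{>-nonZero (Q-at-1-pos k)}} (strictMono-from-step Q-at-1-< k<m) D∣wₖ)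
... | tri≈ _ k≡m _ = k≡m
... | tri> _ _ m<k = ⊥-elim (>⇒∤ {{>-nonZero (Q-at-1-pos (m ∸ s))}} (strictMono-from-step Q-at-1-< m∸s<m)
                               (Equivalence.to (∣-sum-⇔ D∣sum) D∣wₘ₊ₛ))
  where
  s = k ∸ m
  m+s≡k : m + s ≡ k
  m+s≡k = ℕP.m+[n∸m]≡n (ℕP.<⇒≤ m<k)
  s<m : s < m
  s<m = ℕP.+-cancelˡ-< m s m (subst₂ _<_ (sym m+s≡k) (cong (m +_) (ℕP.+-identityʳ m)) k<2m)
  m∸s<m : m ∸ s < m
  m∸s<m = ℕP.∸-monoʳ-< {m} {s} {0} (ℕP.m<n⇒0<n∸m m<k) (ℕP.<⇒≤ s<m)
  D∣sum : Q-at-1 m ∣ Q-at-1 (m + s) + Q-at-1 (m ∸ s)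
  D∣sum = subst (Q-at-1 m ∣_) (sym (Q-at-1-sum-≤ (ℕP.<⇒≤ s<m))) (m∣m*n (Q-at-1 s))
  D∣wₘ₊ₛ : Q-at-1 m ∣ Q-at-1 (m + s)
  D∣wₘ₊ₛ = subst (λ i → Q-at-1 m ∣ Q-at-1 i) (sym m+s≡k) D∣wₖ

Q-at-1-∣⇒OddQuot : ∀ {m n} → m ≥ 1 → Q-at-1 m ∣ Q-at-1 n → OddQuot n m
Q-at-1-∣⇒OddQuot {m} {n} m≥1 D∣wₙ = n / A , (begin
  n                        ≡⟨ n≡r+qA ⟩
  n % A + n / A * A        ≡⟨ cong (_+ n / A * A) (Q-at-1-residue (m%n<n n A) D∣wᵣ) ⟩
  m + n / A * (2 * m)      ≡⟨ collect m (n / A) ⟩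
  (2 * (n / A) + 1) * m    ∎)
  where
  open ≡-Reasoning
  A = 2 * m
  instance
    A≢0 : NonZero A
    A≢0 = >-nonZero (ℕP.≤-trans m≥1 (ℕP.m≤m+n m (m + 0)))
  n≡r+qA : n ≡ n % A + n / A * A
  n≡r+qA = m≡m%n+[m/n]*n n A
  D∣wᵣ : Q-at-1 m ∣ Q-at-1 (n % A)
  D∣wᵣ = Equivalence.to (periodic (λ k → Q-at-1 m ∣ Q-at-1 k) (Q-at-1-period m) (n / A) (n % A))
                        (subst (λ k → Q-at-1 m ∣ Q-at-1 k) n≡r+qA D∣wₙ)
  collect : ∀ m q → m + q * (2 * m) ≡ (2 * q + 1) * m
  collect = solve-∀

Q-divisibility : ∀ {m} n → m ≥ 1 → OddQuot n m ⇔ Qₛ m ∣ₛ Qₛ n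
Q-divisibility {m} n m≥1 = mk⇔ forward (Q-at-1-∣⇒OddQuot m≥1 ∘ Qₛ-∣ₛ⇒Q-at-1-∣)
  where
  reindex : ∀ t m → (2 * t + 1) * m ≡ m + t * (2 * m)
  reindex = solve-∀
  forward : OddQuot n m → Qₛ m ∣ₛ Qₛ n
  forward (t , n≡) = subst (λ k → Qₛ m ∣ₛ Qₛ k) (sym (trans n≡ (reindex t m))) (Qₛ-∣ₛ m t)

-- Differences and sums of powers

module _ (a : ℕ) where

  powDiff : ℕ → ℕ
  powDiff j = (a + 1) ^ j ∸ a ^ j

  powSum : ℕ → ℕ
  powSum j = (a + 1) ^ j + a ^ j

  private
    instance
      a+1≢0 : NonZero (a + 1)
      a+1≢0 = >-nonZero (ℕP.m≤n+m 1 a)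

  a^j+powDiff : ∀ j → a ^ j + powDiff j ≡ (a + 1) ^ j
  a^j+powDiff j = ℕP.m+[n∸m]≡n (ℕP.^-monoˡ-≤ j (ℕP.m≤m+n a 1))

  powDiff-+ : ∀ j A → powDiff (j + A) ≡ (a + 1) ^ j * powDiff A + a ^ A * powDiff j
  powDiff-+ j A = trans (cong (_∸ a ^ (j + A)) (sym total)) (ℕP.m+n∸m≡n (a ^ (j + A)) _)
    where
    open ≡-Reasoning
    expand : ∀ yj Gj yA GA → yj * yA + ((yj + Gj) * GA + yA * Gj) ≡ (yj + Gj) * (yA + GA)
    expand = solve-∀
    total : a ^ (j + A) + ((a + 1) ^ j * powDiff A + a ^ A * powDiff j) ≡ (a + 1) ^ (j + A)
    total = begin
      a ^ (j + A) + ((a + 1) ^ j * powDiff A + a ^ A * powDiff j)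
        ≡⟨ cong₂ (λ u v → u + (v * powDiff A + a ^ A * powDiff j)) (ℕP.^-distribˡ-+-* a j A) (sym (a^j+powDiff j)) ⟩
      a ^ j * a ^ A + ((a ^ j + powDiff j) * powDiff A + a ^ A * powDiff j)
        ≡⟨ expand (a ^ j) (powDiff j) (a ^ A) (powDiff A) ⟩
      (a ^ j + powDiff j) * (a ^ A + powDiff A)
        ≡⟨ cong₂ _*_ (a^j+powDiff j) (a^j+powDiff A) ⟩
      (a + 1) ^ j * (a + 1) ^ A
        ≡⟨ ℕP.^-distribˡ-+-* (a + 1) j A ⟨
      (a + 1) ^ (j + A) ∎

  powSum-+ : ∀ j A → powSum (j + A) + a ^ A * powDiff j ≡ (a + 1) ^ j * powSum A
  powSum-+ j A = begin
    ((a + 1) ^ (j + A) + a ^ (j + A)) + a ^ A * powDiff j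
      ≡⟨ cong₂ (λ u v → (u + v) + a ^ A * powDiff j) (ℕP.^-distribˡ-+-* (a + 1) j A) (ℕP.^-distribˡ-+-* a j A) ⟩
    ((a + 1) ^ j * (a + 1) ^ A + a ^ j * a ^ A) + a ^ A * powDiff j
      ≡⟨ cong (λ u → (u * (a + 1) ^ A + a ^ j * a ^ A) + a ^ A * powDiff j) (a^j+powDiff j) ⟨
    ((a ^ j + powDiff j) * (a + 1) ^ A + a ^ j * a ^ A) + a ^ A * powDiff j
      ≡⟨ expand (a ^ j) (powDiff j) (a ^ A) ((a + 1) ^ A) ⟩
    (a ^ j + powDiff j) * ((a + 1) ^ A + a ^ A)
      ≡⟨ cong (_* powSum A) (a^j+powDiff j) ⟩
    (a + 1) ^ j * powSum A ∎
    where
    open ≡-Reasoning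
    expand : ∀ yj Gj yA xA → ((yj + Gj) * xA + yj * yA) + yA * Gj ≡ (yj + Gj) * (xA + yA)
    expand = solve-∀

  powDiff-+′ : ∀ j A → powDiff (j + A) + a ^ A * powSum j ≡ (a + 1) ^ j * powSum A
  powDiff-+′ j A = begin
    powDiff (j + A) + a ^ A * ((a + 1) ^ j + a ^ j)
      ≡⟨ regroup (powDiff (j + A)) (a ^ A) ((a + 1) ^ j) (a ^ j) ⟩
    (powDiff (j + A) + a ^ j * a ^ A) + a ^ A * (a + 1) ^ j
      ≡⟨ cong (λ u → (powDiff (j + A) + u) + a ^ A * (a + 1) ^ j) (ℕP.^-distribˡ-+-* a j A) ⟨
    (powDiff (j + A) + a ^ (j + A)) + a ^ A * (a + 1) ^ j
      ≡⟨ cong (_+ a ^ A * (a + 1) ^ j) (trans (ℕP.+-comm (powDiff (j + A)) _) (a^j+powDiff (j + A))) ⟩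
    (a + 1) ^ (j + A) + a ^ A * (a + 1) ^ j
      ≡⟨ cong (_+ a ^ A * (a + 1) ^ j) (ℕP.^-distribˡ-+-* (a + 1) j A) ⟩
    (a + 1) ^ j * (a + 1) ^ A + a ^ A * (a + 1) ^ j
      ≡⟨ factor ((a + 1) ^ j) ((a + 1) ^ A) (a ^ A) ⟩
    (a + 1) ^ j * powSum A ∎
    where
    open ≡-Reasoning
    regroup : ∀ g yA xj yj → g + yA * (xj + yj) ≡ (g + yj * yA) + yA * xj
    regroup = solve-∀
    factor : ∀ xj xA yA → xj * xA + yA * xj ≡ xj * (xA + yA)
    factor = solve-∀

  [a+1]^e≡1+a* : ∀ e → ∃[ K ] (a + 1) ^ e ≡ a * K + 1
  [a+1]^e≡1+a* zero = 0 , cong (_+ 1) (sym (ℕP.*-zeroʳ a))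
  [a+1]^e≡1+a* (suc e) with [a+1]^e≡1+a* e
  ... | K , eq = a * K + 1 + K , trans (cong ((a + 1) *_) eq) (expand a K)
    where
    expand : ∀ a K → (a + 1) * (a * K + 1) ≡ a * (a * K + 1 + K) + 1
    expand = solve-∀

  coprime-to-a : ∀ {A D} → 1 ≤ A → (∀ {d} → d ∣ D → d ∣ a ^ A → d ∣ (a + 1) ^ A) → Coprime D a
  coprime-to-a {suc A} _ sum≡⇒difference {d} (d∣D , d∣a) with [a+1]^e≡1+a* (suc A)
  ... | K , eq = ∣1⇒≡1 (∣m+n∣m⇒∣n (subst (d ∣_) eq (sum≡⇒difference d∣D (∣m⇒∣m*n (a ^ A) d∣a))) (∣m⇒∣m*n K d∣a))

  cancel-a^ : ∀ {D} → Coprime D a → ∀ e {H} → D ∣ a ^ e * H ⇔ D ∣ H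
  cancel-a^ {D} coprime e = mk⇔ (cancel e) (∣n⇒∣m*n (a ^ e))
    where
    cancel : ∀ e {H} → D ∣ a ^ e * H → D ∣ H
    cancel zero    {H} D∣ = subst (D ∣_) (ℕP.+-identityʳ H) D∣
    cancel (suc e) {H} D∣ = cancel e (coprime-divisor coprime (subst (D ∣_) (ℕP.*-assoc a (a ^ e) H) D∣))

  powDiff-shift : ∀ {A} → 1 ≤ A → ∀ j → powDiff A ∣ powDiff (j + A) ⇔ powDiff A ∣ powDiff j
  powDiff-shift {A} 1≤A j = ⇔-trans (≡⇒⇔ (powDiff A ∣_) (powDiff-+ j A))
    (⇔-trans (∣-+-⇔ (n∣m*n ((a + 1) ^ j))) (cancel-a^ coprime A))
    where
    coprime : Coprime (powDiff A) a
    coprime = coprime-to-a 1≤A (λ {d} d∣D d∣a^A → subst (d ∣_) (a^j+powDiff A) (∣m∣n⇒∣m+n d∣a^A d∣D))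

  module _ {A} (1≤A : 1 ≤ A) where
    private
      coprime : Coprime (powSum A) a
      coprime = coprime-to-a 1≤A (λ d∣D → Equivalence.from (∣-sum-⇔ d∣D))

    powSum-shift : ∀ j → powSum A ∣ powSum (j + A) ⇔ powSum A ∣ powDiff j
    powSum-shift j = ⇔-trans (∣-sum-⇔ (subst (powSum A ∣_) (sym (powSum-+ j A)) (n∣m*n ((a + 1) ^ j))))
                             (cancel-a^ coprime A)

    powDiff-shift′ : ∀ j → powSum A ∣ powDiff (j + A) ⇔ powSum A ∣ powSum j
    powDiff-shift′ j = ⇔-trans (∣-sum-⇔ (subst (powSum A ∣_) (sym (powDiff-+′ j A)) (n∣m*n ((a + 1) ^ j))))
                               (cancel-a^ coprime A)

    powSum-period : ∀ j → powSum A ∣ powSum (j + 2 * A) ⇔ powSum A ∣ powSum j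
    powSum-period j = ⇔-trans (≡⇒⇔ (λ k → powSum A ∣ powSum k) (regroup j A))
                              (⇔-trans (powSum-shift (j + A)) (powDiff-shift′ j))
      where
      regroup : ∀ j A → j + 2 * A ≡ (j + A) + A
      regroup = solve-∀

  powDiff-suc : ∀ j → powDiff (suc j) ≡ (a + 1) ^ j + a * powDiff j
  powDiff-suc j = trans (cong (_∸ a ^ suc j) (sym total)) (ℕP.m+n∸m≡n (a ^ suc j) _)
    where
    open ≡-Reasoning
    total : a ^ suc j + ((a + 1) ^ j + a * powDiff j) ≡ (a + 1) ^ suc j
    total = begin
      a * a ^ j + ((a + 1) ^ j + a * powDiff j)  ≡⟨ regroup a (a ^ j) ((a + 1) ^ j) (powDiff j) ⟩
      (a + 1) ^ j + a * (a ^ j + powDiff j)      ≡⟨ cong (λ u → (a + 1) ^ j + a * u) (a^j+powDiff j) ⟩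
      (a + 1) ^ j + a * (a + 1) ^ j              ≡⟨ factor a ((a + 1) ^ j) ⟩
      (a + 1) * (a + 1) ^ j                      ∎
      where
      regroup : ∀ a y x g → a * y + (x + a * g) ≡ x + a * (y + g)
      regroup = solve-∀
      factor : ∀ a x → x + a * x ≡ (a + 1) * x
      factor = solve-∀

  powDiff-pos : ∀ r → 0 < powDiff (suc r)
  powDiff-pos r = ℕP.m<n⇒0<n∸m (ℕP.^-monoˡ-< (suc r) (ℕP.m<m+n a (s≤s z≤n)))

  module _ (1≤a : 1 ≤ a) where
    private
      instance
        a≢0 : NonZero a
        a≢0 = >-nonZero 1≤a

    powDiff-< : ∀ j → powDiff j < powDiff (suc j)
    powDiff-< j = subst (powDiff j <_) (sym (powDiff-suc j))
                        (ℕP.+-mono-<-≤ (ℕP.m^n>0 (a + 1) j) (ℕP.m≤n*m (powDiff j) a))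

    powDiff-residue : ∀ {A r} → r < A → powDiff A ∣ powDiff r ⇔ r ≡ 0
    powDiff-residue {A} {zero}  _   = mk⇔ (λ _ → refl) (λ _ → powDiff A ∣0)
    powDiff-residue {A} {suc r} r<A =
      mk⇔ (⊥-elim ∘ >⇒∤ {{>-nonZero (powDiff-pos r)}} (strictMono-from-step powDiff-< r<A)) λ ()

    private
      [a+1]^-< : ∀ {r A} → r < A → (a + 1) ^ r < (a + 1) ^ A
      [a+1]^-< = ℕP.^-monoʳ-< (a + 1) (ℕP.+-monoˡ-≤ 1 1≤a)

    powSum-∤ : ∀ {A r} → r < A → powSum A ∣ powSum r → ⊥
    powSum-∤ {A} {r} r<A = >⇒∤ {{>-nonZero (ℕP.<-≤-trans (ℕP.m^n>0 (a + 1) r) (ℕP.m≤m+n _ (a ^ r)))}}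
                               (ℕP.+-mono-<-≤ ([a+1]^-< r<A) (ℕP.^-monoʳ-≤ a (ℕP.<⇒≤ r<A)))

    powSum-residue : ∀ {A r} → r < A → powSum A ∣ powDiff r → r ≡ 0
    powSum-residue {A} {zero}  _   _  = refl
    powSum-residue {A} {suc r} r<A D∣ = ⊥-elim (>⇒∤ {{>-nonZero (powDiff-pos r)}} below D∣)
      where
      below : powDiff (suc r) < powSum A
      below = ℕP.≤-<-trans (ℕP.m∸n≤m _ (a ^ suc r)) (ℕP.<-≤-trans ([a+1]^-< r<A) (ℕP.m≤m+n _ (a ^ A)))

    powDiff-∣-⇔ : ∀ {A} → 1 ≤ A → ∀ B → A ∣ B ⇔ powDiff A ∣ powDiff B
    powDiff-∣-⇔ {A} 1≤A B =
      ⇔-trans (⇔-sym (m%n≡0⇔n∣m B A))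
      (⇔-trans (⇔-sym (powDiff-residue (m%n<n B A)))
      (⇔-sym (⇔-trans (≡⇒⇔ (λ k → powDiff A ∣ powDiff k) (m≡m%n+[m/n]*n B A))
                      (periodic (λ k → powDiff A ∣ powDiff k) (powDiff-shift 1≤A) (B / A) (B % A)))))
      where
      instance
        A≢0 : NonZero A
        A≢0 = >-nonZero 1≤A

    module _ {A} (1≤A : 1 ≤ A) where
      private
        instance
          A≢0 : NonZero A
          A≢0 = >-nonZero 1≤A
        D = powSum A
        at : ∀ {i j} → i ≡ j → D ∣ powSum i → D ∣ powSum j
        at = subst (λ k → D ∣ powSum k)
        period : ∀ q r → D ∣ powSum (r + q * (2 * A)) ⇔ D ∣ powSum r
        period = periodic (λ k → D ∣ powSum k) (powSum-period 1≤A)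

      odd-multiple⇒powSum-∣ : ∀ t → powSum A ∣ powSum ((2 * t + 1) * A)
      odd-multiple⇒powSum-∣ t = at (reindex t A) (Equivalence.from (period t A) n∣n)
        where
        reindex : ∀ t A → A + t * (2 * A) ≡ (2 * t + 1) * A
        reindex = solve-∀

      powSum-∣⇒odd-multiple : ∀ B → powSum A ∣ powSum B → ∃[ t ] B ≡ (2 * t + 1) * A
      powSum-∣⇒odd-multiple B D∣ with even-or-odd (B / A)
      ... | inj₁ (t , q≡2t) = ⊥-elim (powSum-∤ (m%n<n B A) (Equivalence.to (period t (B % A)) (at B≡ D∣)))
        where
        regroup : ∀ r t A → r + 2 * t * A ≡ r + t * (2 * A)
        regroup = solve-∀
        B≡ : B ≡ B % A + t * (2 * A)
        B≡ = trans (m≡m%n+[m/n]*n B A) (trans (cong (λ u → B % A + u * A) q≡2t) (regroup (B % A) t A))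
      ... | inj₂ (t , q≡2t+1) = t , trans B≡ (cong (λ u → u + (2 * t + 1) * A) r≡0)
        where
        B≡ : B ≡ B % A + (2 * t + 1) * A
        B≡ = trans (m≡m%n+[m/n]*n B A) (cong (λ u → B % A + u * A) q≡2t+1)
        regroup : ∀ r t A → r + (2 * t + 1) * A ≡ (r + A) + t * (2 * A)
        regroup = solve-∀
        r≡0 : B % A ≡ 0
        r≡0 = powSum-residue (m%n<n B A) (Equivalence.to (powSum-shift 1≤A (B % A))
                (Equivalence.to (period t (B % A + A)) (at (trans B≡ (regroup (B % A) t A)) D∣)))

    powSum-∣-⇔ : ∀ {m} → 1 ≤ m → ∀ n → OddQuot n m ⇔ powSum (2 * m) ∣ powSum (2 * n)
    powSum-∣-⇔ {m} 1≤m n = mk⇔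
      (λ (t , n≡) → subst (λ k → powSum (2 * m) ∣ powSum k) (sym (doubled {t} n≡)) (odd-multiple⇒powSum-∣ 1≤2m t))
      (λ D∣ → let t , 2n≡ = powSum-∣⇒odd-multiple 1≤2m (2 * n) D∣
              in t , ℕP.*-cancelˡ-≡ n ((2 * t + 1) * m) 2 (trans 2n≡ (swap t m)))
      where
      1≤2m : 1 ≤ 2 * m
      1≤2m = ℕP.≤-trans 1≤m (ℕP.m≤m+n m (m + 0))
      swap : ∀ t m → (2 * t + 1) * (2 * m) ≡ 2 * ((2 * t + 1) * m)
      swap = solve-∀
      doubled : ∀ {t} → n ≡ (2 * t + 1) * m → 2 * n ≡ (2 * t + 1) * (2 * m)
      doubled {t} n≡ = trans (cong (2 *_) n≡) (sym (swap t m))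

theorem4 : (m n : ℕ) → m ≥ 1 → n ≥ 1 →
    (((2 * m + 1 ∣ 2 * n + 1) ⇔ (P m ∣ₚ P n)) × ((2 * m + 1 ∣ 2 * n + 1) ⇔ (PInv m ∣ₚ PInv n)))
    × ((OddQuot n m ⇔ (Q m ∣ₚ Q n)) × (OddQuot n m ⇔ (QInv m ∣ₚ QInv n)))
    × ((a : ℕ) → a ≥ 1 →
        (2 * m + 1 ∣ 2 * n + 1) ⇔ (((a + 1) ^ (2 * m + 1) ∸ a ^ (2 * m + 1)) ∣ ((a + 1) ^ (2 * n + 1) ∸ a ^ (2 * n + 1))))
    × ((a : ℕ) → a ≥ 1 →
        OddQuot n m ⇔ (((a + 1) ^ (2 * m) + a ^ (2 * m)) ∣ ((a + 1) ^ (2 * n) + a ^ (2 * n))))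
theorem4 m n m≥1 _ =
    ( ⇔-trans (P-divisibility m n) (⇔-sym (table-∣ₚ⇔ T-vanish m n))
    , ⇔-trans (P-divisibility m n) (⇔-sym (reverse-table-∣ₚ⇔ T-vanish T-const≢0 T-lead≢0 m n)) )
  , ( ⇔-trans (Q-divisibility n m≥1) (⇔-sym (table-∣ₚ⇔ U-vanish m n))
    , ⇔-trans (Q-divisibility n m≥1) (⇔-sym (reverse-table-∣ₚ⇔ U-vanish U-const≢0 U-lead≢0 m n)) )
  , (λ a a≥1 → powDiff-∣-⇔ a a≥1 (ℕP.m≤n+m 1 (2 * m)) (2 * n + 1))
  , (λ a a≥1 → powSum-∣-⇔ a a≥1 m≥1 n)
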